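{- Let $\eta=(\eta_1,\dots,\eta_r)$ be a composition of $n$ (i.e. $\eta_i\in\mathbb{N}=\{1,2,\dots\}$ and $\eta_1+\dots+\eta_r=n$). Then, as formal power series in $t$ with coefficients in $\mathbb{Q}(q)$, $$\frac{C_{S_{\eta}}(q,t)}{\prod_{i=0}^n (1-q^i t)} = \sum_{k\geq 0} \prod_{i=1}^r \binom{k+\eta_i}{\eta_i}_q t^k = \mathrm{Ehr}_{\Delta_{\eta},\boldsymbol{\mu}_{\eta}}(q,t).$$
   Context: $S_\eta$ is the set of multiset permutations $w=w_1\dots w_n$ of the multiset containing $\eta_j$ copies of $j$ for each $j\in[r]$. Its descent set is $\mathrm{Des}(w)=\{i\in[n-1]: w_i>w_{i+1}\}$, $\mathrm{maj}(w)=\sum_{i\in\mathrm{Des}(w)} i$, $\mathrm{des}(w)=|\mathrm{Des}(w)|$, and $C_{S_\eta}(q,t)=\sum_{w\in S_\eta} q^{\mathrm{maj}(w)}t^{\mathrm{des}(w)}$. The $q$-binomial coefficient is $\binom{m}{j}_q=\frac{[m]_q!}{[m-j]_q![j]_q!}$ with $[m]_q!=[m]_q\cdots[1]_q$, $[m]_q=\frac{1-q^m}{1-q}$. $\Delta_m=\{x\in\mathbb{R}^m: x_i\ge 0,\ x_1+\dots+x_m\le 1\}$ is the standard simplex. For $k\ge 0$ and $x\in k\Delta_m\cap\mathbb{Z}^m$ define the weight $\mu_{k,m}(x)=\sum_{i=1}^m\bigl(k-\sum_{l=i}^m x_l\bigr)$ (i.e. the coordinate sum of $\phi_{k,m}(x)=(k-\sum_{l=1}^m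 x_l,\,k-\sum_{l=2}^m x_l,\dots,k-x_m)$). Let $\Delta_\eta=\Delta_{\eta_1}\times\dots\times\Delta_{\eta_r}\subset\mathbb{R}^n$ and for $x=(x_1,\dots,x_r)\in k\Delta_\eta\cap\mathbb{Z}^n$ with $x_i\in k\Delta_{\eta_i}$ put $\mu_{k,\eta}(x)=\sum_{i=1}^r\mu_{k,\eta_i}(x_i)$. The weighted Ehrhart series is $\mathrm{Ehr}_{\Delta_\eta,\boldsymbol{\mu}_\eta}(q,t)=\sum_{k\ge0}\sum_{x\in k\Delta_\eta\cap\mathbb{Z}^n} q^{\mu_{k,\eta}(x)}t^k$. -}

module Defs where

open import Data.Nat as ℕ using (ℕ; zero; suc; _∸_; _≤_; _<ᵇ_; _≡ᵇ_)
open import Data.Integer as ℤ using (ℤ; +_; -_)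
open import Data.List using (List; []; _∷_; map; foldr; length; filter; upTo; concatMap; zip; reverse)
open import Data.Bool.ListAction using (and)
import Data.List as L
open import Data.Bool using (Bool; true; false; if_then_else_; _∧_)
open import Data.Product using (_,_)
open import Relation.Binary.PropositionalEquality using (_≡_)
open import Data.Nat.ListAction using (sum)

-- Formal power series in one variable q with integer coefficients:
-- a series is its coefficient function  d ↦ [q^d].
-- (Q(q) embeds into Q((q)); all rational functions occurring here have
-- denominators with constant term 1, so they are power series in q.)

PS : Set
PS = ℕ → ℤ

zeroS : PS
zeroS _ = + 0

oneS : PS
oneS zero    = + 1
oneS (suc _) = + 0

qpow : ℕ → PS
qpow m d = if m ≡ᵇ d then + 1 else + 0

_+S_ : PS → PS → PS
(a +S b) d = a d ℤ.+ b d

negS : PS → PS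
negS a d = - a d

_-S_ : PS → PS → PS
a -S b = a +S negS b

_*S_ : PS → PS → PS
(a *S b) d = foldr (λ i s → a i ℤ.* b (d ∸ i) ℤ.+ s) (+ 0) (upTo (suc d))

-- Generic inverse of a power series  a = a₀ + a₁ x + …  with a₀ = 1,
-- over coefficients in any type with the ring operations:
--   b₀ = 1,  b_{d} = - Σ_{j=1}^{d} a_j b_{d-j}.
-- invRev d = [b_d , … , b_0].

module Inverse {A : Set} (z o : A) (_⊕_ _⊗_ : A → A → A) (neg : A → A) where

  invRev : (ℕ → A) → ℕ → List A
  invRev a zero    = o ∷ []
  invRev a (suc d) =
    let bs = invRev a d
        js = map suc (upTo (suc d))
    in neg (foldr (λ p s → (a (Data.Product.proj₁ p) ⊗ Data.Product.proj₂ p) ⊕ s) z (zip js bs)) ∷ bs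

  inv : (ℕ → A) → ℕ → A
  inv a d with invRev a d
  ... | []    = z
  ... | b ∷ _ = b

invS : PS → PS
invS = Inverse.inv (+ 0) (+ 1) ℤ._+_ ℤ._*_ (-_)

qint : ℕ → PS
qint m = (oneS -S qpow m) *S invS (oneS -S qpow 1)

qfact : ℕ → PS
qfact zero    = oneS
qfact (suc m) = qint (suc m) *S qfact m

qbinom : ℕ → ℕ → PS
qbinom m j = qfact m *S invS (qfact (m ∸ j) *S qfact j)

-- Formal power series in t whose coefficients are power series in q:
-- F k = [t^k] F.

BS : Set
BS = ℕ → PS

zeroB : BS
zeroB _ = zeroS

oneB : BS
oneB zero    = oneS
oneB (suc _) = zeroS

_+B_ : BS → BS → BS
(A +B B) k = A k +S B k

_*B_ : BS → BS → BS
(A *B B) k = foldr (λ j s → (A j *S B (k ∸ j)) +S s) zeroS (upTo (suc k))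

invB : BS → BS
invB = Inverse.inv zeroS oneS _+S_ _*S_ negS

monoB : ℕ → ℕ → BS
monoB d k k' = if k ≡ᵇ k' then qpow d else zeroS

sumB : List BS → BS
sumB = foldr _+B_ zeroB

prodB : List BS → BS
prodB = foldr _*B_ oneB

-- Multiset permutations.  Letters are 1 , … , r.
-- η is given as a list (η₁ , … , η_r).

words : ℕ → ℕ → List (List ℕ)
words r zero    = [] ∷ []
words r (suc n) = concatMap (λ a → map (a ∷_) (words r n)) (map suc (upTo r))

count : ℕ → List ℕ → ℕ
count j w = foldr (λ a c → if a ≡ᵇ j then suc c else c) 0 w

hasContent : List ℕ → List ℕ → Bool
hasContent η w = and (L.zipWith (λ j e → count j w ≡ᵇ e) (map suc (upTo (length η))) η)

Sη : List ℕ → List (List ℕ)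
Sη η = filter (λ w → hasContent η w Data.Bool.≟ true) (words (length η) (sum η))

desFrom : ℕ → List ℕ → List ℕ
desFrom i []            = []
desFrom i (a ∷ [])      = []
desFrom i (a ∷ b ∷ w)   = if b <ᵇ a then i ∷ desFrom (suc i) (b ∷ w) else desFrom (suc i) (b ∷ w)

Des : List ℕ → List ℕ
Des = desFrom 1

maj : List ℕ → ℕ
maj w = sum (Des w)

des : List ℕ → ℕ
des w = length (Des w)

C : List ℕ → BS
C η = sumB (map (λ w → monoB (maj w) (des w)) (Sη η))

denom : ℕ → BS
denom n = prodB (map (λ i → oneB +B (λ k → negS (monoB i 1 k))) (upTo (suc n)))

middle : List ℕ → BS
middle η k = foldr (λ e s → qbinom (k ℕ.+ e) e *S s) oneS η

vecsBounded : ℕ → ℕ → List (List ℕ)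
vecsBounded k zero    = [] ∷ []
vecsBounded k (suc m) = concatMap (λ a → map (a ∷_) (vecsBounded k m)) (upTo (suc k))

simplexPts : ℕ → ℕ → List (List ℕ)
simplexPts k m = filter (λ x → sum x ℕ.≤? k) (vecsBounded k m)

-- lattice points of k Δ_η = kΔ_{η₁} × ⋯ × kΔ_{η_r}, as lists of blocks
prodPts : ℕ → List ℕ → List (List (List ℕ))
prodPts k []      = [] ∷ []
prodPts k (e ∷ η) = concatMap (λ x → map (x ∷_) (prodPts k η)) (simplexPts k e)

μ : ℕ → List ℕ → ℕ
μ k []      = 0
μ k (a ∷ x) = (k ∸ sum (a ∷ x)) ℕ.+ μ k x

μη : ℕ → List (List ℕ) → ℕ
μη k xs = sum (map (μ k) xs)

Ehr : List ℕ → BS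
Ehr η k = foldr (λ x s → qpow (μη k x) +S s) zeroS (prodPts k η)

_≈B_ : BS → BS → Set
A ≈B B = ∀ k d → A k d ≡ B k d

module Submission where

-- Write [k+m choose m]_q as the generating function, by sum of entries, of the
-- size-m multisets from {0,…,k}.  Summing out one coordinate at a time shows that
-- the μ-weighted lattice points of kΔ_m are counted by [k+m choose m]_q, and
-- kΔ_η is a product of simplices; this is the second equation.  By the q-Pascal
-- rule, Σ_k [k+n choose n]_q t^k inverts ∏_{i=0}^n (1 − q^i t), so the t^k
-- coefficient of the left-hand side is Σ_{w ∈ S_η} q^(maj w) [k − des w + n choose n]_q.
-- This counts (MacMahon) the pairs of w ∈ S_η and a sequence k ≥ f₁ ≥ ⋯ ≥ fₙ ≥ 0
-- that is strict at the descents of w.  Sorting the pairs (fᵢ, wᵢ) by decreasing value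
-- and increasing letter identifies these with η-tuples of multisets from {0,…,k},
-- counted by ∏ᵢ [k+ηᵢ choose ηᵢ]_q; the bijection is carried out as an induction
-- on n and k that splits off the smallest letter taking the value k.

open import Defs
open import Data.Nat using (ℕ; _≤_)
open import Data.Nat.ListAction using (sum)
open import Data.List using (List)
open import Data.List.Relation.Unary.All using (All)
open import Data.Product using (_×_)

open import Algebra.Bundles using (CommutativeRing)
open import Level using (0ℓ)
open import Data.Nat as ℕ using (zero; suc; _∸_; _<_; z<s; s<s; s≤s; z≤n; _≤?_; _<?_; _≟_; _≤ᵇ_; _<ᵇ_; _≡ᵇ_)
import Data.Nat.Properties as ℕP
open import Data.List using ([]; _∷_; _++_; foldr; map; length; upTo; applyUpTo; zip; concatMap; filter)
open import Data.List.Properties using (map-upTo; foldr-map)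
open import Data.Bool using (Bool; true; false; if_then_else_; T; _∧_; not)
open import Data.Product using (_,_; proj₁; proj₂)
open import Function using (_∘_)
open import Relation.Nullary using (does; yes; no)
open import Relation.Nullary.Decidable using (dec-true; dec-false)
open import Relation.Unary using (Pred; Decidable)
import Relation.Binary.PropositionalEquality as P
open P using (_≡_)

foldr-upTo-suc : ∀ {B : Set} (f : ℕ → B → B) (z : B) n →
  foldr f z (upTo (suc n)) ≡ f 0 (foldr (f ∘ suc) z (upTo n))
foldr-upTo-suc f z n =
  P.cong (f 0) (P.trans (P.cong (foldr f z) (P.sym (map-upTo suc n))) (foldr-map f suc z (upTo n)))

zip-applyUpTo : ∀ {A B : Set} (f : ℕ → A) (g : ℕ → B) n →
  zip (applyUpTo f n) (applyUpTo g n) ≡ applyUpTo (λ i → f i , g i) n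
zip-applyUpTo f g zero = P.refl
zip-applyUpTo f g (suc n) = P.cong ((f 0 , g 0) ∷_) (zip-applyUpTo (f ∘ suc) (g ∘ suc) n)

module PowerSeries (R : CommutativeRing 0ℓ 0ℓ) where

  open CommutativeRing R
  open import Algebra.Properties.CommutativeSemigroup +-commutativeSemigroup
    using (interchange)
  open import Relation.Binary.Reasoning.Setoid setoid

  ∑ : ℕ → (ℕ → Carrier) → Carrier
  ∑ n g = foldr (λ i s → g i + s) 0# (upTo n)

  ∑-suc : ∀ n g → ∑ (suc n) g ≡ g 0 + ∑ n (g ∘ suc)
  ∑-suc n g = foldr-upTo-suc (λ i s → g i + s) 0# n

  ∑-cong : ∀ n {g h} → (∀ i → i < n → g i ≈ h i) → ∑ n g ≈ ∑ n h
  ∑-cong zero e = refl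
  ∑-cong (suc n) {g} {h} e = begin
    ∑ (suc n) g          ≡⟨ ∑-suc n g ⟩
    g 0 + ∑ n (g ∘ suc)  ≈⟨ +-cong (e 0 z<s) (∑-cong n (λ i i<n → e (suc i) (s<s i<n))) ⟩
    h 0 + ∑ n (h ∘ suc)  ≡⟨ P.sym (∑-suc n h) ⟩
    ∑ (suc n) h          ∎

  ∑-sucʳ : ∀ n g → ∑ (suc n) g ≈ ∑ n g + g n
  ∑-sucʳ zero g = trans (+-identityʳ _) (sym (+-identityˡ _))
  ∑-sucʳ (suc n) g = begin
    ∑ (suc (suc n)) g                ≡⟨ ∑-suc (suc n) g ⟩
    g 0 + ∑ (suc n) (g ∘ suc)        ≈⟨ +-congˡ (∑-sucʳ n (g ∘ suc)) ⟩
    g 0 + (∑ n (g ∘ suc) + g (suc n)) ≈⟨ sym (+-assoc _ _ _) ⟩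
    (g 0 + ∑ n (g ∘ suc)) + g (suc n) ≡⟨ P.cong (_+ g (suc n)) (P.sym (∑-suc n g)) ⟩
    ∑ (suc n) g + g (suc n)          ∎

  ∑-zero : ∀ n → ∑ n (λ _ → 0#) ≈ 0#
  ∑-zero zero = refl
  ∑-zero (suc n) = trans (reflexive (∑-suc n _)) (trans (+-congˡ (∑-zero n)) (+-identityʳ _))

  ∑-+ : ∀ n g h → ∑ n (λ i → g i + h i) ≈ ∑ n g + ∑ n h
  ∑-+ zero g h = sym (+-identityʳ _)
  ∑-+ (suc n) g h = begin
    ∑ (suc n) (λ i → g i + h i)                       ≡⟨ ∑-suc n _ ⟩
    (g 0 + h 0) + ∑ n (λ i → g (suc i) + h (suc i))   ≈⟨ +-congˡ (∑-+ n (g ∘ suc) (h ∘ suc)) ⟩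
    (g 0 + h 0) + (∑ n (g ∘ suc) + ∑ n (h ∘ suc))     ≈⟨ interchange _ _ _ _ ⟩
    (g 0 + ∑ n (g ∘ suc)) + (h 0 + ∑ n (h ∘ suc))     ≡⟨ P.sym (P.cong₂ _+_ (∑-suc n g) (∑-suc n h)) ⟩
    ∑ (suc n) g + ∑ (suc n) h                         ∎

  ∑-*ˡ : ∀ n x g → x * ∑ n g ≈ ∑ n (λ i → x * g i)
  ∑-*ˡ zero x g = zeroʳ x
  ∑-*ˡ (suc n) x g = begin
    x * ∑ (suc n) g                     ≡⟨ P.cong (x *_) (∑-suc n g) ⟩
    x * (g 0 + ∑ n (g ∘ suc))           ≈⟨ distribˡ _ _ _ ⟩
    x * g 0 + x * ∑ n (g ∘ suc)         ≈⟨ +-congˡ (∑-*ˡ n x (g ∘ suc)) ⟩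
    x * g 0 + ∑ n (λ i → x * g (suc i)) ≡⟨ P.sym (∑-suc n _) ⟩
    ∑ (suc n) (λ i → x * g i)           ∎

  ∑-*ʳ : ∀ n x g → ∑ n g * x ≈ ∑ n (λ i → g i * x)
  ∑-*ʳ n x g = trans (*-comm _ _) (trans (∑-*ˡ n x g) (∑-cong n (λ i _ → *-comm _ _)))

  ∑-+-split : ∀ m n g → ∑ (m ℕ.+ n) g ≈ ∑ m g + ∑ n (λ i → g (m ℕ.+ i))
  ∑-+-split zero n g = sym (+-identityˡ _)
  ∑-+-split (suc m) n g = begin
    ∑ (suc m ℕ.+ n) g                                        ≡⟨ ∑-suc (m ℕ.+ n) g ⟩
    g 0 + ∑ (m ℕ.+ n) (g ∘ suc)                              ≈⟨ +-congˡ (∑-+-split m n (g ∘ suc)) ⟩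
    g 0 + (∑ m (g ∘ suc) + ∑ n (λ i → g (suc m ℕ.+ i)))      ≈⟨ sym (+-assoc _ _ _) ⟩
    (g 0 + ∑ m (g ∘ suc)) + ∑ n (λ i → g (suc m ℕ.+ i))      ≡⟨ P.cong (_+ ∑ n (λ i → g (suc m ℕ.+ i))) (P.sym (∑-suc m g)) ⟩
    ∑ (suc m) g + ∑ n (λ i → g (suc m ℕ.+ i))                ∎

  ∑-reverse : ∀ n g → ∑ (suc n) (λ i → g (n ∸ i)) ≈ ∑ (suc n) g
  ∑-reverse zero g = refl
  ∑-reverse (suc n) g = begin
    ∑ (suc (suc n)) (λ i → g (suc n ∸ i))     ≡⟨ ∑-suc (suc n) _ ⟩
    g (suc n) + ∑ (suc n) (λ i → g (n ∸ i))   ≈⟨ +-congˡ (∑-reverse n g) ⟩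
    g (suc n) + ∑ (suc n) g                   ≈⟨ +-comm _ _ ⟩
    ∑ (suc n) g + g (suc n)                   ≈⟨ sym (∑-sucʳ (suc n) g) ⟩
    ∑ (suc (suc n)) g                         ∎

  ∑ᴸ : ∀ {A : Set} → List A → (A → Carrier) → Carrier
  ∑ᴸ xs f = foldr (λ x s → f x + s) 0# xs

  module _ {A : Set} where

    ∑ᴸ-cong : ∀ (xs : List A) {f g} → (∀ x → f x ≈ g x) → ∑ᴸ xs f ≈ ∑ᴸ xs g
    ∑ᴸ-cong [] e = refl
    ∑ᴸ-cong (x ∷ xs) e = +-cong (e x) (∑ᴸ-cong xs e)

    ∑ᴸ-zero : ∀ (xs : List A) → ∑ᴸ xs (λ _ → 0#) ≈ 0#
    ∑ᴸ-zero [] = refl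
    ∑ᴸ-zero (x ∷ xs) = trans (+-congˡ (∑ᴸ-zero xs)) (+-identityʳ _)

    ∑ᴸ-++ : ∀ (xs ys : List A) f → ∑ᴸ (xs ++ ys) f ≈ ∑ᴸ xs f + ∑ᴸ ys f
    ∑ᴸ-++ [] ys f = sym (+-identityˡ _)
    ∑ᴸ-++ (x ∷ xs) ys f = trans (+-congˡ (∑ᴸ-++ xs ys f)) (sym (+-assoc _ _ _))

    ∑ᴸ-+ : ∀ (xs : List A) f g → ∑ᴸ xs (λ x → f x + g x) ≈ ∑ᴸ xs f + ∑ᴸ xs g
    ∑ᴸ-+ [] f g = sym (+-identityʳ _)
    ∑ᴸ-+ (x ∷ xs) f g = trans (+-congˡ (∑ᴸ-+ xs f g)) (interchange _ _ _ _)

    ∑ᴸ-*ˡ : ∀ (xs : List A) y f → y * ∑ᴸ xs f ≈ ∑ᴸ xs (λ x → y * f x)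
    ∑ᴸ-*ˡ [] y f = zeroʳ y
    ∑ᴸ-*ˡ (x ∷ xs) y f = trans (distribˡ _ _ _) (+-congˡ (∑ᴸ-*ˡ xs y f))

    ∑ᴸ-*ʳ : ∀ (xs : List A) y f → ∑ᴸ xs f * y ≈ ∑ᴸ xs (λ x → f x * y)
    ∑ᴸ-*ʳ xs y f = trans (*-comm _ _) (trans (∑ᴸ-*ˡ xs y f) (∑ᴸ-cong xs (λ x → *-comm _ _)))

    ∑ᴸ-filter : ∀ {p} {P : Pred A p} (P? : Decidable P) (xs : List A) f →
      ∑ᴸ (filter P? xs) f ≈ ∑ᴸ xs (λ x → if does (P? x) then f x else 0#)
    ∑ᴸ-filter P? [] f = refl
    ∑ᴸ-filter P? (x ∷ xs) f with does (P? x)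
    ... | true  = +-congˡ (∑ᴸ-filter P? xs f)
    ... | false = trans (∑ᴸ-filter P? xs f) (sym (+-identityˡ _))

  ∑ᴸ-map : ∀ {A B : Set} (h : A → B) (xs : List A) f → ∑ᴸ (map h xs) f ≡ ∑ᴸ xs (f ∘ h)
  ∑ᴸ-map h xs f = foldr-map (λ x s → f x + s) h 0# xs

  ∑ᴸ-concatMap : ∀ {A B : Set} (g : A → List B) (xs : List A) f →
    ∑ᴸ (concatMap g xs) f ≈ ∑ᴸ xs (λ x → ∑ᴸ (g x) f)
  ∑ᴸ-concatMap g [] f = refl
  ∑ᴸ-concatMap g (x ∷ xs) f = trans (∑ᴸ-++ (g x) (concatMap g xs) f) (+-congˡ (∑ᴸ-concatMap g xs f))

  ∑ᴸ-swap : ∀ {A B : Set} (xs : List A) (ys : List B) (f : A → B → Carrier) →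
    ∑ᴸ xs (λ x → ∑ᴸ ys (f x)) ≈ ∑ᴸ ys (λ y → ∑ᴸ xs (λ x → f x y))
  ∑ᴸ-swap [] ys f = sym (∑ᴸ-zero ys)
  ∑ᴸ-swap (x ∷ xs) ys f = trans (+-congˡ (∑ᴸ-swap xs ys f)) (sym (∑ᴸ-+ ys (f x) _))

  Series : Set
  Series = ℕ → Carrier

  infix 4 _≋_
  _≋_ : Series → Series → Set
  f ≋ g = ∀ d → f d ≈ g d

  conv : Series → Series → Series
  conv a b d = ∑ (suc d) (λ i → a i * b (d ∸ i))

  conv-suc : ∀ a b d → conv a b (suc d) ≡ a 0 * b (suc d) + conv (a ∘ suc) b d
  conv-suc a b d = ∑-suc (suc d) (λ i → a i * b (suc d ∸ i))

  conv-constantTerm : ∀ a b → conv a b 0 ≈ a 0 * b 0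
  conv-constantTerm a b = +-identityʳ _

  conv-cong : ∀ {a a′ b b′} → (∀ i → a i ≈ a′ i) → (∀ i → b i ≈ b′ i) →
              ∀ d → conv a b d ≈ conv a′ b′ d
  conv-cong ea eb d = ∑-cong (suc d) (λ i _ → *-cong (ea i) (eb (d ∸ i)))

  conv-distribʳ : ∀ a a′ b d → conv (λ i → a i + a′ i) b d ≈ conv a b d + conv a′ b d
  conv-distribʳ a a′ b d =
    trans (∑-cong (suc d) (λ i _ → distribʳ _ _ _)) (∑-+ (suc d) _ _)

  conv-*ˡ : ∀ x a b d → conv (λ i → x * a i) b d ≈ x * conv a b d
  conv-*ˡ x a b d =
    trans (∑-cong (suc d) (λ i _ → *-assoc _ _ _)) (sym (∑-*ˡ (suc d) x _))

  conv-zeroˡ : ∀ b d → conv (λ _ → 0#) b d ≈ 0#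
  conv-zeroˡ b d = trans (∑-cong (suc d) (λ i _ → zeroˡ _)) (∑-zero (suc d))

  conv-shiftˡ : ∀ a b d → a 0 ≈ 0# → conv a b (suc d) ≈ conv (a ∘ suc) b d
  conv-shiftˡ a b d a₀≈0 = begin
    conv a b (suc d)                    ≡⟨ conv-suc a b d ⟩
    a 0 * b (suc d) + conv (a ∘ suc) b d ≈⟨ +-congʳ (trans (*-congʳ a₀≈0) (zeroˡ _)) ⟩
    0# + conv (a ∘ suc) b d             ≈⟨ +-identityˡ _ ⟩
    conv (a ∘ suc) b d                  ∎

  conv-constantˡ : ∀ b g → (∀ j → b (suc j) ≈ 0#) → ∀ d → conv b g d ≈ b 0 * g d
  conv-constantˡ b g b₊≈0 zero = conv-constantTerm b g
  conv-constantˡ b g b₊≈0 (suc d) = begin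
    conv b g (suc d)                    ≡⟨ conv-suc b g d ⟩
    b 0 * g (suc d) + conv (b ∘ suc) g d ≈⟨ +-congˡ (trans (conv-cong {b ∘ suc} {λ _ → 0#} {g} {g} b₊≈0 (λ _ → refl) d)
                                                          (conv-zeroˡ g d)) ⟩
    b 0 * g (suc d) + 0#                ≈⟨ +-identityʳ _ ⟩
    b 0 * g (suc d)                     ∎

  conv-comm : ∀ a b d → conv a b d ≈ conv b a d
  conv-comm a b d = begin
    conv a b d                                       ≈⟨ sym (∑-reverse d (λ i → a i * b (d ∸ i))) ⟩
    ∑ (suc d) (λ i → a (d ∸ i) * b (d ∸ (d ∸ i)))    ≈⟨ ∑-cong (suc d) swapFactors ⟩
    conv b a d                                       ∎
    where
    swapFactors : ∀ i → i < suc d → a (d ∸ i) * b (d ∸ (d ∸ i)) ≈ b i * a (d ∸ i)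
    swapFactors i (s≤s i≤d) = trans (*-comm _ _) (*-congʳ (reflexive (P.cong b (ℕP.m∸[m∸n]≡n i≤d))))

  conv-assoc : ∀ a b e d → conv (conv a b) e d ≈ conv a (conv b e) d
  conv-assoc a b e zero = begin
    conv (conv a b) e 0   ≈⟨ trans (conv-constantTerm (conv a b) e) (*-congʳ (conv-constantTerm a b)) ⟩
    a 0 * b 0 * e 0       ≈⟨ *-assoc _ _ _ ⟩
    a 0 * (b 0 * e 0)     ≈⟨ sym (trans (conv-constantTerm a (conv b e)) (*-congˡ (conv-constantTerm b e))) ⟩
    conv a (conv b e) 0   ∎
  conv-assoc a b e (suc d) = begin
    conv (conv a b) e (suc d)
      ≡⟨ conv-suc (conv a b) e d ⟩
    conv a b 0 * e (suc d) + conv (λ i → conv a b (suc i)) e d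
      ≈⟨ +-congˡ (conv-cong {b = e} (λ i → reflexive (conv-suc a b i)) (λ _ → refl) d) ⟩
    conv a b 0 * e (suc d) + conv (λ i → a 0 * b (suc i) + conv (a ∘ suc) b i) e d
      ≈⟨ +-congˡ (conv-distribʳ _ _ e d) ⟩
    conv a b 0 * e (suc d) + (conv (λ i → a 0 * b (suc i)) e d + conv (conv (a ∘ suc) b) e d)
      ≈⟨ +-cong (*-congʳ (conv-constantTerm a b)) (+-cong (conv-*ˡ (a 0) (b ∘ suc) e d) (conv-assoc (a ∘ suc) b e d)) ⟩
    a 0 * b 0 * e (suc d) + (a 0 * conv (b ∘ suc) e d + conv (a ∘ suc) (conv b e) d)
      ≈⟨ trans (+-congʳ (*-assoc _ _ _)) (trans (sym (+-assoc _ _ _)) (+-congʳ (sym (distribˡ _ _ _)))) ⟩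
    a 0 * (b 0 * e (suc d) + conv (b ∘ suc) e d) + conv (a ∘ suc) (conv b e) d
      ≡⟨ P.cong (λ z → a 0 * z + conv (a ∘ suc) (conv b e) d) (P.sym (conv-suc b e d)) ⟩
    a 0 * conv b e (suc d) + conv (a ∘ suc) (conv b e) d
      ≡⟨ P.sym (conv-suc a (conv b e) d) ⟩
    conv a (conv b e) (suc d) ∎

  one : Series
  one zero    = 1#
  one (suc _) = 0#

  conv-identityˡ : ∀ b d → conv one b d ≈ b d
  conv-identityˡ b zero = trans (conv-constantTerm one b) (*-identityˡ _)
  conv-identityˡ b (suc d) = begin
    conv one b (suc d)                   ≡⟨ conv-suc one b d ⟩
    1# * b (suc d) + conv (one ∘ suc) b d ≈⟨ +-cong (*-identityˡ _) (conv-zeroˡ b d) ⟩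
    b (suc d) + 0#                       ≈⟨ +-identityʳ _ ⟩
    b (suc d)                            ∎

  -- The unit is a parameter since oneS and oneB agree with one only coefficientwise.
  seriesRing : (o : Series) → o ≋ one → CommutativeRing 0ℓ 0ℓ
  seriesRing o o≋one = record
    { Carrier = Series ; _≈_ = _≋_ ; _+_ = λ a b d → a d + b d ; _*_ = conv
    ; -_ = λ a d → - a d ; 0# = λ _ → 0# ; 1# = o
    ; isCommutativeRing = record
      { isRing = record
        { +-isAbelianGroup = record
          { isGroup = record
            { isMonoid = record
              { isSemigroup = record
                { isMagma = record
                  { isEquivalence = record
                    { refl = λ d → refl ; sym = λ e d → sym (e d) ; trans = λ e f d → trans (e d) (f d) }
                  ; ∙-cong = λ e f d → +-cong (e d) (f d) }
                ; assoc = λ a b e d → +-assoc _ _ _ }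
              ; identity = (λ a d → +-identityˡ _) , (λ a d → +-identityʳ _) }
            ; inverse = (λ a d → -‿inverseˡ _) , (λ a d → -‿inverseʳ _)
            ; ⁻¹-cong = λ e d → -‿cong (e d) }
          ; comm = λ a b d → +-comm _ _ }
        ; *-cong = conv-cong
        ; *-assoc = conv-assoc
        ; *-identity = identityˡ , λ a d → trans (conv-comm a o d) (identityˡ a d)
        ; distrib = (λ a b e d → trans (conv-comm a _ d)
                       (trans (conv-distribʳ b e a d) (+-cong (conv-comm b a d) (conv-comm e a d))))
                  , (λ a b e → conv-distribʳ b e a) }
      ; *-comm = conv-comm } }
    where
    identityˡ : ∀ a → conv o a ≋ a
    identityˡ a d = trans (conv-cong {b = a} o≋one (λ _ → refl) d) (conv-identityˡ a d)

  inverse : Series → Series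
  inverse = Inverse.inv 0# 1# _+_ _*_ (-_)

  inverse-suc : ∀ a d → inverse a (suc d) ≡ - conv (a ∘ suc) (inverse a) d
  inverse-suc a d = P.cong -_ (P.trans
    (P.cong₂ (λ u v → foldr step 0# (zip u v)) (map-upTo suc (suc d)) (invRev≡ d)) (P.trans
    (P.cong (foldr step 0#) (zip-applyUpTo suc (λ i → inverse a (d ∸ i)) (suc d))) (P.trans
    (P.cong (foldr step 0#) (P.sym (map-upTo _ (suc d))))
    (foldr-map step _ 0# (upTo (suc d))))))
    where
    step : ℕ × Carrier → Carrier → Carrier
    step p s = a (proj₁ p) * proj₂ p + s
    invRev : ℕ → List Carrier
    invRev = Inverse.invRev 0# 1# _+_ _*_ (-_) a
    invRev≡ : ∀ d → invRev d ≡ applyUpTo (λ i → inverse a (d ∸ i)) (suc d)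
    invRev≡ zero = P.refl
    invRev≡ (suc d) = P.cong (inverse a (suc d) ∷_) (invRev≡ d)

  conv-inverseʳ : ∀ a → a 0 ≈ 1# → ∀ d → conv a (inverse a) d ≈ one d
  conv-inverseʳ a a₀≈1 zero = trans (conv-constantTerm a (inverse a)) (trans (*-congʳ a₀≈1) (*-identityˡ _))
  conv-inverseʳ a a₀≈1 (suc d) = begin
    conv a (inverse a) (suc d)                      ≡⟨ conv-suc a (inverse a) d ⟩
    a 0 * inverse a (suc d) + X                     ≡⟨ P.cong (λ z → a 0 * z + X) (inverse-suc a d) ⟩
    a 0 * (- X) + X                                 ≈⟨ +-congʳ (trans (*-congʳ a₀≈1) (*-identityˡ _)) ⟩
    - X + X                                         ≈⟨ -‿inverseˡ _ ⟩
    0#                                              ∎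
    where X = conv (a ∘ suc) (inverse a) d


module QSeries where

  open import Data.Integer as ℤ using (ℤ; +_)
  import Data.Integer.Properties as ℤP

  module ℤSeries = PowerSeries ℤP.+-*-commutativeRing

  oneS≋one : oneS ℤSeries.≋ ℤSeries.one
  oneS≋one zero    = P.refl
  oneS≋one (suc d) = P.refl

  qSeriesRing : CommutativeRing 0ℓ 0ℓ
  qSeriesRing = ℤSeries.seriesRing oneS oneS≋one

  module Q = CommutativeRing qSeriesRing
  module Qᴾ = PowerSeries qSeriesRing
  open Qᴾ using (∑)
  open import Algebra.Properties.CommutativeSemigroup Q.*-commutativeSemigroup
    using () renaming (x∙yz≈y∙xz to *-x∙yz≈y∙xz; interchange to *-interchange)
  open import Algebra.Properties.Ring Q.ring using (-‿distribʳ-*)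
  open import Relation.Binary.Reasoning.Setoid Q.setoid

  infix 4 _≐_
  _≐_ : PS → PS → Set
  _≐_ = Q._≈_

  *S-congˡ : ∀ a {b c} → b ≐ c → a *S b ≐ a *S c
  *S-congˡ a e = ℤSeries.conv-cong {a} {a} (λ _ → P.refl) e

  *S-congʳ : ∀ c {a b} → a ≐ b → a *S c ≐ b *S c
  *S-congʳ c e = ℤSeries.conv-cong {b = c} {b′ = c} e (λ _ → P.refl)

  +S-congˡ : ∀ a {b c} → b ≐ c → a +S b ≐ a +S c
  +S-congˡ a e d = P.cong (λ z → a d ℤ.+ z) (e d)

  +S-congʳ : ∀ c {a b} → a ≐ b → a +S c ≐ b +S c
  +S-congʳ c e d = P.cong (λ z → z ℤ.+ c d) (e d)

  x≐y+z⇒x-z≐y : ∀ {a b c} → a ≐ b +S c → a -S c ≐ b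
  x≐y+z⇒x-z≐y {a} {b} {c} a≐b+c = Q.trans (+S-congʳ (negS c) a≐b+c)
    (Q.trans (Q.+-assoc b c (negS c)) (Q.trans (+S-congˡ b (Q.-‿inverseʳ c)) (Q.+-identityʳ b)))

  qpow-zero : qpow 0 ≐ oneS
  qpow-zero zero    = P.refl
  qpow-zero (suc d) = P.refl

  qpow-+ : ∀ m n → qpow (m ℕ.+ n) ≐ qpow m *S qpow n
  qpow-+ zero n = Q.sym (Q.trans (*S-congʳ (qpow n) qpow-zero) (Q.*-identityˡ (qpow n)))
  qpow-+ (suc m) n zero =
    P.sym (P.trans (ℤSeries.conv-constantTerm (qpow (suc m)) (qpow n)) (ℤP.*-zeroˡ (qpow n 0)))
  qpow-+ (suc m) n (suc d) =
    P.trans (qpow-+ m n d) (P.sym (ℤSeries.conv-shiftˡ (qpow (suc m)) (qpow n) d P.refl))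

  qint-+ : ∀ a b → qint (a ℕ.+ b) ≐ qint a +S (qpow a *S qint b)
  qint-+ a b = Q.sym (begin
    ((oneS -S X) *S u⁻¹) +S (X *S ((oneS -S Y) *S u⁻¹)) ≈⟨ +S-congˡ ((oneS -S X) *S u⁻¹) (Q.sym (Q.*-assoc X (oneS -S Y) u⁻¹)) ⟩
    ((oneS -S X) *S u⁻¹) +S ((X *S (oneS -S Y)) *S u⁻¹) ≈⟨ Q.sym (Q.distribʳ u⁻¹ (oneS -S X) _) ⟩
    ((oneS -S X) +S (X *S (oneS -S Y))) *S u⁻¹          ≈⟨ *S-congʳ u⁻¹ numerator ⟩
    (oneS -S qpow (a ℕ.+ b)) *S u⁻¹                     ∎)
    where
    X = qpow a
    Y = qpow b
    u⁻¹ = invS (oneS -S qpow 1)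
    numerator : (oneS -S X) +S (X *S (oneS -S Y)) ≐ oneS -S qpow (a ℕ.+ b)
    numerator = begin
      (oneS -S X) +S (X *S (oneS -S Y))             ≈⟨ +S-congˡ (oneS -S X) (Q.distribˡ X oneS (negS Y)) ⟩
      (oneS -S X) +S ((X *S oneS) +S (X *S negS Y)) ≈⟨ +S-congˡ (oneS -S X) (Q.+-cong (Q.*-identityʳ X) (Q.sym (-‿distribʳ-* X Y))) ⟩
      (oneS -S X) +S (X -S (X *S Y))                ≈⟨ Q.+-assoc oneS (negS X) (X -S (X *S Y)) ⟩
      oneS +S (negS X +S (X -S (X *S Y)))           ≈⟨ +S-congˡ oneS (Q.sym (Q.+-assoc (negS X) X (negS (X *S Y)))) ⟩
      oneS +S ((negS X +S X) -S (X *S Y))           ≈⟨ +S-congˡ oneS (Q.trans (+S-congʳ (negS (X *S Y)) (Q.-‿inverseˡ X)) (Q.+-identityˡ _)) ⟩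
      oneS -S (X *S Y)                              ≈⟨ +S-congˡ oneS (Q.-‿cong (Q.sym (qpow-+ a b))) ⟩
      oneS -S qpow (a ℕ.+ b)                        ∎

  qfact-constant : ∀ n → qfact n 0 ≡ + 1
  qfact-constant zero = P.refl
  qfact-constant (suc n) =
    P.trans (ℤSeries.conv-constantTerm (qint (suc n)) (qfact n))
    (P.trans (P.cong (qint (suc n) 0 ℤ.*_) (qfact-constant n))
    (P.trans (ℤP.*-identityʳ _)
             (ℤSeries.conv-constantTerm (oneS -S qpow (suc n)) (invS (oneS -S qpow 1)))))

  qfact-cast : ∀ {m n} → m ≡ n → qfact m ≐ qfact n
  qfact-cast P.refl d = P.refl

  qfact*qfact-constant : ∀ m n → (qfact m *S qfact n) 0 ≡ + 1
  qfact*qfact-constant m n = P.trans (ℤSeries.conv-constantTerm (qfact m) (qfact n))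
                                     (P.cong₂ ℤ._*_ (qfact-constant m) (qfact-constant n))

  *S-invSʳ : ∀ a → a 0 ≡ + 1 → a *S invS a ≐ oneS
  *S-invSʳ a a₀≡1 d = P.trans (ℤSeries.conv-inverseʳ a a₀≡1 d) (P.sym (oneS≋one d))

  *S-cancelˡ : ∀ a {b c} → a 0 ≡ + 1 → a *S b ≐ a *S c → b ≐ c
  *S-cancelˡ a {b} {c} a₀≡1 e = begin
    b                        ≈⟨ Q.sym (Q.*-identityˡ b) ⟩
    oneS *S b                ≈⟨ *S-congʳ b (Q.sym (Q.trans (Q.*-comm (invS a) a) (*S-invSʳ a a₀≡1))) ⟩
    (invS a *S a) *S b       ≈⟨ Q.*-assoc (invS a) a b ⟩
    invS a *S (a *S b)       ≈⟨ *S-congˡ (invS a) e ⟩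
    invS a *S (a *S c)       ≈⟨ Q.sym (Q.*-assoc (invS a) a c) ⟩
    (invS a *S a) *S c       ≈⟨ *S-congʳ c (Q.trans (Q.*-comm (invS a) a) (*S-invSʳ a a₀≡1)) ⟩
    oneS *S c                ≈⟨ Q.*-identityˡ c ⟩
    c                        ∎

  -- [s+m choose m]_q, as the generating function of size-m multisets from
  -- {0,…,s} weighted by q^(sum); the recursion chooses the largest element b.
  qMultiset : ℕ → ℕ → PS
  qMultiset s zero    = oneS
  qMultiset s (suc m) = ∑ (suc s) (λ b → qpow b *S qMultiset b m)

  qMultiset-zeroˡ : ∀ m → qMultiset 0 m ≐ oneS
  qMultiset-zeroˡ zero = Q.refl {oneS}
  qMultiset-zeroˡ (suc m) = begin
    (qpow 0 *S qMultiset 0 m) +S zeroS ≈⟨ Q.+-identityʳ (qpow 0 *S qMultiset 0 m) ⟩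
    qpow 0 *S qMultiset 0 m            ≈⟨ ℤSeries.conv-cong qpow-zero (qMultiset-zeroˡ m) ⟩
    oneS *S oneS                       ≈⟨ Q.*-identityˡ oneS ⟩
    oneS                               ∎

  qMultiset-pascal : ∀ s m →
    qMultiset (suc s) (suc m) ≐ qMultiset s (suc m) +S (qpow (suc s) *S qMultiset (suc s) m)
  qMultiset-pascal s m = Qᴾ.∑-sucʳ (suc s) (λ b → qpow b *S qMultiset b m)

  qMultiset-qfact : ∀ s m → qMultiset s m *S (qfact s *S qfact m) ≐ qfact (s ℕ.+ m)
  qMultiset-qfact s zero = begin
    oneS *S (qfact s *S oneS) ≈⟨ Q.*-identityˡ (qfact s *S oneS) ⟩
    qfact s *S oneS           ≈⟨ Q.*-identityʳ (qfact s) ⟩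
    qfact s                   ≈⟨ qfact-cast (P.sym (ℕP.+-identityʳ s)) ⟩
    qfact (s ℕ.+ 0)           ∎
  qMultiset-qfact zero (suc m) = begin
    qMultiset 0 (suc m) *S (oneS *S qfact (suc m)) ≈⟨ *S-congʳ (oneS *S qfact (suc m)) (qMultiset-zeroˡ (suc m)) ⟩
    oneS *S (oneS *S qfact (suc m))                ≈⟨ Q.*-identityˡ (oneS *S qfact (suc m)) ⟩
    oneS *S qfact (suc m)                          ≈⟨ Q.*-identityˡ (qfact (suc m)) ⟩
    qfact (suc m)                                  ∎
  qMultiset-qfact (suc s) (suc m) = begin
    qMultiset (suc s) (suc m) *S F                       ≈⟨ *S-congʳ F (qMultiset-pascal s m) ⟩
    (A +S (Qs *S B)) *S F                                ≈⟨ Q.distribʳ F A (Qs *S B) ⟩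
    (A *S F) +S ((Qs *S B) *S F)                         ≈⟨ Q.+-cong largestBelow largestEqual ⟩
    (qint (suc s) *S qfact N) +S ((Qs *S qint (suc m)) *S qfact N)
                                                         ≈⟨ Q.sym (Q.distribʳ (qfact N) (qint (suc s)) (Qs *S qint (suc m))) ⟩
    (qint (suc s) +S (Qs *S qint (suc m))) *S qfact N    ≈⟨ *S-congʳ (qfact N) (Q.sym (qint-+ (suc s) (suc m))) ⟩
    qint (suc N) *S qfact N                              ∎
    where
    N = s ℕ.+ suc m
    A = qMultiset s (suc m)
    B = qMultiset (suc s) m
    Qs = qpow (suc s)
    F = qfact (suc s) *S qfact (suc m)
    largestBelow : A *S F ≐ qint (suc s) *S qfact N
    largestBelow = begin
      A *S ((qint (suc s) *S qfact s) *S qfact (suc m)) ≈⟨ *S-congˡ A (Q.*-assoc (qint (suc s)) (qfact s) (qfact (suc m))) ⟩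
      A *S (qint (suc s) *S (qfact s *S qfact (suc m))) ≈⟨ *-x∙yz≈y∙xz A (qint (suc s)) (qfact s *S qfact (suc m)) ⟩
      qint (suc s) *S (A *S (qfact s *S qfact (suc m))) ≈⟨ *S-congˡ (qint (suc s)) (qMultiset-qfact s (suc m)) ⟩
      qint (suc s) *S qfact N                           ∎
    largestEqual : (Qs *S B) *S F ≐ (Qs *S qint (suc m)) *S qfact N
    largestEqual = begin
      (Qs *S B) *S (qfact (suc s) *S (qint (suc m) *S qfact m))
        ≈⟨ *S-congˡ (Qs *S B) (*-x∙yz≈y∙xz (qfact (suc s)) (qint (suc m)) (qfact m)) ⟩
      (Qs *S B) *S (qint (suc m) *S (qfact (suc s) *S qfact m))
        ≈⟨ *-interchange Qs B (qint (suc m)) (qfact (suc s) *S qfact m) ⟩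
      (Qs *S qint (suc m)) *S (B *S (qfact (suc s) *S qfact m))
        ≈⟨ *S-congˡ (Qs *S qint (suc m)) (qMultiset-qfact (suc s) m) ⟩
      (Qs *S qint (suc m)) *S qfact (suc s ℕ.+ m)
        ≈⟨ *S-congˡ (Qs *S qint (suc m)) (qfact-cast (P.sym (ℕP.+-suc s m))) ⟩
      (Qs *S qint (suc m)) *S qfact N ∎

  qbinom≐qMultiset : ∀ k e → qbinom (k ℕ.+ e) e ≐ qMultiset k e
  qbinom≐qMultiset k e = begin
    qfact (k ℕ.+ e) *S invS (qfact (k ℕ.+ e ∸ e) *S qfact e)
      ≈⟨ *S-congˡ (qfact (k ℕ.+ e)) (λ d → P.cong (λ n → invS (qfact n *S qfact e) d) (ℕP.m+n∸n≡m k e)) ⟩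
    qfact (k ℕ.+ e) *S invS F            ≈⟨ *S-congʳ (invS F) (Q.sym (qMultiset-qfact k e)) ⟩
    (qMultiset k e *S F) *S invS F       ≈⟨ Q.*-assoc (qMultiset k e) F (invS F) ⟩
    qMultiset k e *S (F *S invS F)       ≈⟨ *S-congˡ (qMultiset k e) (*S-invSʳ F (qfact*qfact-constant k e)) ⟩
    qMultiset k e *S oneS                ≈⟨ Q.*-identityʳ (qMultiset k e) ⟩
    qMultiset k e                        ∎
    where F = qfact k *S qfact e

  qMultiset-comm : ∀ s m → qMultiset s m ≐ qMultiset m s
  qMultiset-comm s m = *S-cancelˡ (qfact s *S qfact m) (qfact*qfact-constant s m) (begin
    (qfact s *S qfact m) *S qMultiset s m  ≈⟨ Q.*-comm (qfact s *S qfact m) (qMultiset s m) ⟩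
    qMultiset s m *S (qfact s *S qfact m)  ≈⟨ qMultiset-qfact s m ⟩
    qfact (s ℕ.+ m)                        ≈⟨ qfact-cast (ℕP.+-comm s m) ⟩
    qfact (m ℕ.+ s)                        ≈⟨ Q.sym (qMultiset-qfact m s) ⟩
    qMultiset m s *S (qfact m *S qfact s)  ≈⟨ *S-congˡ (qMultiset m s) (Q.*-comm (qfact m) (qfact s)) ⟩
    qMultiset m s *S (qfact s *S qfact m)  ≈⟨ Q.*-comm (qMultiset m s) (qfact s *S qfact m) ⟩
    (qfact s *S qfact m) *S qMultiset m s  ∎)

  qMultiset-pascal′ : ∀ s m →
    qMultiset (suc s) (suc m) ≐ qMultiset (suc s) m +S (qpow (suc m) *S qMultiset s (suc m))
  qMultiset-pascal′ s m = begin
    qMultiset (suc s) (suc m)  ≈⟨ qMultiset-comm (suc s) (suc m) ⟩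
    qMultiset (suc m) (suc s)  ≈⟨ qMultiset-pascal m s ⟩
    qMultiset m (suc s) +S (qpow (suc m) *S qMultiset (suc m) s)
      ≈⟨ Q.+-cong (qMultiset-comm m (suc s)) (*S-congˡ (qpow (suc m)) (qMultiset-comm (suc m) s)) ⟩
    qMultiset (suc s) m +S (qpow (suc m) *S qMultiset s (suc m)) ∎


module EhrhartSide where

  open QSeries
  open Qᴾ using (∑; ∑ᴸ)
  open import Relation.Binary.Reasoning.Setoid Q.setoid

  qPrefixSum : (ℕ → PS) → ℕ → PS
  qPrefixSum f s = ∑ (suc s) (λ b → qpow b *S f b)

  -- Weights each point x of kΔ_m by f at its slack k − |x|; for f = const 1
  -- this is the μ-weighted lattice point count of kΔ_m.
  simplexSum : (ℕ → PS) → ℕ → ℕ → PS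
  simplexSum f k m = ∑ᴸ (simplexPts k m) (λ x → f (k ∸ sum x) *S qpow (μ k x))

  if-true : ∀ {b} {x y : PS} → b ≡ true → x ≐ (if b then x else y)
  if-true P.refl = Q.refl

  if-false : ∀ {b} {x y : PS} → b ≡ false → y ≐ (if b then x else y)
  if-false P.refl = Q.refl

  firstCoordinateTerm : (ℕ → PS) → ℕ → ℕ → ℕ → ℕ → PS
  firstCoordinateTerm f k s M a =
    if does (a ℕ.+ s ≤? k) then f (k ∸ (a ℕ.+ s)) *S qpow (k ∸ (a ℕ.+ s) ℕ.+ M) else zeroS

  ∑-firstCoordinateTerm : ∀ f k s M →
    ∑ (suc k) (firstCoordinateTerm f k s M)
      ≐ (if s ℕ.≤ᵇ k then qPrefixSum f (k ∸ s) *S qpow M else zeroS)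
  ∑-firstCoordinateTerm f k s M with s ≤? k
  ... | no s≰k = Q.trans (Qᴾ.∑-cong (suc k) (λ a _ → vanishes a))
                         (Q.trans (Qᴾ.∑-zero (suc k)) (if-false (dec-false (s ≤? k) s≰k)))
    where
    vanishes : ∀ a → firstCoordinateTerm f k s M a ≐ zeroS
    vanishes a rewrite dec-false (a ℕ.+ s ≤? k) (λ a+s≤k → s≰k (ℕP.≤-trans (ℕP.m≤n+m s a) a+s≤k))
      = Q.refl {zeroS}
  ... | yes s≤k = Q.trans (begin
    ∑ (suc k) term                                    ≡⟨ P.cong (λ n → ∑ n term) (P.cong suc (P.sym (ℕP.m∸n+n≡m s≤k))) ⟩
    ∑ (suc N ℕ.+ s) term                              ≈⟨ Qᴾ.∑-+-split (suc N) s term ⟩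
    ∑ (suc N) term +S ∑ s (λ i → term (suc N ℕ.+ i))     ≈⟨ Q.+-cong (Qᴾ.∑-cong (suc N) inRange)
                                                       (Q.trans (Qᴾ.∑-cong s (λ i _ → outOfRange i)) (Qᴾ.∑-zero s)) ⟩
    ∑ (suc N) (λ a → g (N ∸ a) *S qpow M) +S zeroS ≈⟨ Q.+-identityʳ _ ⟩
    ∑ (suc N) (λ a → g (N ∸ a) *S qpow M)          ≈⟨ Q.sym (Qᴾ.∑-*ʳ (suc N) (qpow M) (λ a → g (N ∸ a))) ⟩
    ∑ (suc N) (λ a → g (N ∸ a)) *S qpow M          ≈⟨ *S-congʳ (qpow M) (Qᴾ.∑-reverse N g) ⟩
    qPrefixSum f N *S qpow M                       ∎) (if-true (dec-true (s ≤? k) s≤k))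
    where
    N = k ∸ s
    term = firstCoordinateTerm f k s M
    g : ℕ → PS
    g b = qpow b *S f b
    inRange : ∀ a → a < suc N → term a ≐ g (N ∸ a) *S qpow M
    inRange a (s≤s a≤N)
      rewrite dec-true (a ℕ.+ s ≤? k)
                (P.subst (a ℕ.+ s ≤_) (ℕP.m∸n+n≡m s≤k) (ℕP.+-monoˡ-≤ s a≤N))
            | P.sym (P.trans (ℕP.∸-+-assoc k s a) (P.cong (k ∸_) (ℕP.+-comm s a))) = begin
      f (N ∸ a) *S qpow (N ∸ a ℕ.+ M)          ≈⟨ *S-congˡ (f (N ∸ a)) (qpow-+ (N ∸ a) M) ⟩
      f (N ∸ a) *S (qpow (N ∸ a) *S qpow M)    ≈⟨ Q.sym (Q.*-assoc (f (N ∸ a)) (qpow (N ∸ a)) (qpow M)) ⟩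
      (f (N ∸ a) *S qpow (N ∸ a)) *S qpow M    ≈⟨ *S-congʳ (qpow M) (Q.*-comm (f (N ∸ a)) (qpow (N ∸ a))) ⟩
      g (N ∸ a) *S qpow M                      ∎
    k<a+s : ∀ i → k < suc N ℕ.+ i ℕ.+ s
    k<a+s i = P.subst (λ n → suc n ≤ suc N ℕ.+ i ℕ.+ s) (ℕP.m∸n+n≡m s≤k)
                      (ℕP.+-monoˡ-≤ s (ℕP.m≤m+n (suc N) i))
    outOfRange : ∀ i → term (suc N ℕ.+ i) ≐ zeroS
    outOfRange i rewrite dec-false (suc N ℕ.+ i ℕ.+ s ≤? k) (ℕP.<⇒≱ (k<a+s i)) = Q.refl {zeroS}

  simplexSum-suc : ∀ f k m → simplexSum f k (suc m) ≐ simplexSum (qPrefixSum f) k m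
  simplexSum-suc f k m = begin
    ∑ᴸ (filter (λ x → sum x ≤? k) (vecsBounded k (suc m))) F
      ≈⟨ Qᴾ.∑ᴸ-filter (λ x → sum x ≤? k) (vecsBounded k (suc m)) F ⟩
    ∑ᴸ (concatMap (λ a → map (a ∷_) (vecsBounded k m)) (upTo (suc k))) G
      ≈⟨ Qᴾ.∑ᴸ-concatMap (λ a → map (a ∷_) (vecsBounded k m)) (upTo (suc k)) G ⟩
    ∑ᴸ (upTo (suc k)) (λ a → ∑ᴸ (map (a ∷_) (vecsBounded k m)) G)
      ≈⟨ Qᴾ.∑ᴸ-cong (upTo (suc k)) (λ a → Q.reflexive (Qᴾ.∑ᴸ-map (a ∷_) (vecsBounded k m) G)) ⟩
    ∑ (suc k) (λ a → ∑ᴸ (vecsBounded k m) (λ x → G (a ∷ x)))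
      ≈⟨ Qᴾ.∑ᴸ-swap (upTo (suc k)) (vecsBounded k m) (λ a x → G (a ∷ x)) ⟩
    ∑ᴸ (vecsBounded k m) (λ x → ∑ (suc k) (firstCoordinateTerm f k (sum x) (μ k x)))
      ≈⟨ Qᴾ.∑ᴸ-cong (vecsBounded k m) (λ x → ∑-firstCoordinateTerm f k (sum x) (μ k x)) ⟩
    ∑ᴸ (vecsBounded k m) (λ x → if does (sum x ≤? k) then qPrefixSum f (k ∸ sum x) *S qpow (μ k x) else zeroS)
      ≈⟨ Q.sym (Qᴾ.∑ᴸ-filter (λ x → sum x ≤? k) (vecsBounded k m) (λ x → qPrefixSum f (k ∸ sum x) *S qpow (μ k x))) ⟩
    simplexSum (qPrefixSum f) k m ∎
    where
    F : List ℕ → PS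
    F x = f (k ∸ sum x) *S qpow (μ k x)
    G : List ℕ → PS
    G x = if does (sum x ≤? k) then F x else zeroS

  simplexSum-zero : ∀ f k → simplexSum f k 0 ≐ f k
  simplexSum-zero f k = Q.trans (Q.+-identityʳ (f k *S qpow 0))
                                (Q.trans (*S-congˡ (f k) qpow-zero) (Q.*-identityʳ (f k)))

  simplexSum-qMultiset : ∀ m j k → simplexSum (λ s → qMultiset s j) k m ≐ qMultiset k (m ℕ.+ j)
  simplexSum-qMultiset zero j k = simplexSum-zero (λ s → qMultiset s j) k
  simplexSum-qMultiset (suc m) j k = begin
    simplexSum (λ s → qMultiset s j) k (suc m)  ≈⟨ simplexSum-suc (λ s → qMultiset s j) k m ⟩
    simplexSum (λ s → qMultiset s (suc j)) k m  ≈⟨ simplexSum-qMultiset m (suc j) k ⟩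
    qMultiset k (m ℕ.+ suc j)                   ≡⟨ P.cong (qMultiset k) (ℕP.+-suc m j) ⟩
    qMultiset k (suc m ℕ.+ j)                   ∎

  simplex-μ-sum : ∀ k m → ∑ᴸ (simplexPts k m) (λ x → qpow (μ k x)) ≐ qMultiset k m
  simplex-μ-sum k m = begin
    ∑ᴸ (simplexPts k m) (λ x → qpow (μ k x))  ≈⟨ Qᴾ.∑ᴸ-cong (simplexPts k m) (λ x → Q.sym (Q.*-identityˡ (qpow (μ k x)))) ⟩
    simplexSum (λ s → qMultiset s 0) k m      ≈⟨ simplexSum-qMultiset m 0 k ⟩
    qMultiset k (m ℕ.+ 0)                     ≡⟨ P.cong (qMultiset k) (ℕP.+-identityʳ m) ⟩
    qMultiset k m                             ∎

  qMultisetProduct : ℕ → List ℕ → PS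
  qMultisetProduct k η = foldr (λ e s → qMultiset k e *S s) oneS η

  Ehr≐qMultisetProduct : ∀ η k → Ehr η k ≐ qMultisetProduct k η
  Ehr≐qMultisetProduct [] k = Q.trans (Q.+-identityʳ (qpow 0)) qpow-zero
  Ehr≐qMultisetProduct (e ∷ η) k = begin
    ∑ᴸ (concatMap (λ x → map (x ∷_) (prodPts k η)) (simplexPts k e)) (λ xs → qpow (μη k xs))
      ≈⟨ Qᴾ.∑ᴸ-concatMap (λ x → map (x ∷_) (prodPts k η)) (simplexPts k e) (λ xs → qpow (μη k xs)) ⟩
    ∑ᴸ (simplexPts k e) (λ x → ∑ᴸ (map (x ∷_) (prodPts k η)) (λ xs → qpow (μη k xs)))
      ≈⟨ Qᴾ.∑ᴸ-cong (simplexPts k e) (λ x → Q.reflexive (Qᴾ.∑ᴸ-map (x ∷_) (prodPts k η) (λ xs → qpow (μη k xs)))) ⟩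
    ∑ᴸ (simplexPts k e) (λ x → ∑ᴸ (prodPts k η) (λ xs → qpow (μ k x ℕ.+ μη k xs)))
      ≈⟨ Qᴾ.∑ᴸ-cong (simplexPts k e) (λ x → Q.trans (Qᴾ.∑ᴸ-cong (prodPts k η) (λ xs → qpow-+ (μ k x) (μη k xs)))
           (Q.sym (Qᴾ.∑ᴸ-*ˡ (prodPts k η) (qpow (μ k x)) (λ xs → qpow (μη k xs))))) ⟩
    ∑ᴸ (simplexPts k e) (λ x → qpow (μ k x) *S Ehr η k)
      ≈⟨ Q.sym (Qᴾ.∑ᴸ-*ʳ (simplexPts k e) (Ehr η k) (λ x → qpow (μ k x))) ⟩
    ∑ᴸ (simplexPts k e) (λ x → qpow (μ k x)) *S Ehr η k
      ≈⟨ Q.*-cong (simplex-μ-sum k e) (Ehr≐qMultisetProduct η k) ⟩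
    qMultiset k e *S qMultisetProduct k η ∎

  middle≐qMultisetProduct : ∀ η k → middle η k ≐ qMultisetProduct k η
  middle≐qMultisetProduct [] k = Q.refl {oneS}
  middle≐qMultisetProduct (e ∷ η) k =
    Q.*-cong (qbinom≐qMultiset k e) (middle≐qMultisetProduct η k)


module Denominator where

  open QSeries
  import Relation.Binary.Reasoning.Setoid
  open import Data.List using ([_])
  open import Data.List.Properties using (map-++; upTo-∷ʳ)
  open import Data.List.Membership.Propositional using (_∈_)
  open import Data.List.Membership.Propositional.Properties using (∈-map⁻)
  open import Data.List.Relation.Unary.Any using (here; there)
  open import Algebra.Properties.Ring Q.ring using (-‿distribˡ-*)

  oneB≋one : oneB Qᴾ.≋ Qᴾ.one
  oneB≋one zero    = Q.refl {oneS}
  oneB≋one (suc k) = Q.refl {zeroS}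

  tSeriesRing : CommutativeRing 0ℓ 0ℓ
  tSeriesRing = Qᴾ.seriesRing oneB oneB≋one

  module B = CommutativeRing tSeriesRing
  module ≑-Reasoning = Relation.Binary.Reasoning.Setoid B.setoid
  module ≐-Reasoning = Relation.Binary.Reasoning.Setoid Q.setoid

  infix 4 _≑_
  _≑_ : BS → BS → Set
  _≑_ = B._≈_

  *B-congˡ : ∀ a {b c} → b ≑ c → a *B b ≑ a *B c
  *B-congˡ a e = Qᴾ.conv-cong {a} {a} (λ k → Q.refl {a k}) e

  *B-congʳ : ∀ c {a b} → a ≑ b → a *B c ≑ b *B c
  *B-congʳ c e = Qᴾ.conv-cong {b = c} {b′ = c} e (λ k → Q.refl {c k})

  invB-unique : ∀ a c → a 0 ≐ oneS → a *B c ≑ oneB → c ≑ invB a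
  invB-unique a c a₀≐1 ac≑1 = begin
    c                  ≈⟨ B.sym (B.*-identityʳ c) ⟩
    c *B oneB          ≈⟨ *B-congˡ c (B.sym a*invBa≑1) ⟩
    c *B (a *B invB a) ≈⟨ B.sym (B.*-assoc c a (invB a)) ⟩
    (c *B a) *B invB a ≈⟨ *B-congʳ (invB a) (B.trans (B.*-comm c a) ac≑1) ⟩
    oneB *B invB a     ≈⟨ B.*-identityˡ (invB a) ⟩
    invB a             ∎
    where
    open ≑-Reasoning
    a*invBa≑1 : a *B invB a ≑ oneB
    a*invBa≑1 k = Q.trans (Qᴾ.conv-inverseʳ a a₀≐1 k) (Q.sym (oneB≋one k))

  prodB-++ : ∀ xs ys → prodB (xs ++ ys) ≑ prodB xs *B prodB ys
  prodB-++ []       ys = B.sym (B.*-identityˡ (prodB ys))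
  prodB-++ (x ∷ xs) ys = B.trans (*B-congˡ x (prodB-++ xs ys)) (B.sym (B.*-assoc x (prodB xs) (prodB ys)))

  prodB-constant : ∀ xs → (∀ x → x ∈ xs → x 0 ≐ oneS) → prodB xs 0 ≐ oneS
  prodB-constant []       _ = Q.refl {oneS}
  prodB-constant (x ∷ xs) constant = Q.trans (Qᴾ.conv-constantTerm x (prodB xs))
    (Q.trans (Q.*-cong (constant x (here P.refl)) (prodB-constant xs (λ y y∈xs → constant y (there y∈xs))))
             (Q.*-identityˡ oneS))

  linearFactor : ℕ → BS
  linearFactor i = oneB +B (λ k → negS (monoB i 1 k))

  denom-suc : ∀ n → denom (suc n) ≑ denom n *B linearFactor (suc n)
  denom-suc n = begin
    prodB (map linearFactor (upTo (suc (suc n))))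
      ≡⟨ P.cong (prodB ∘ map linearFactor) (P.sym (upTo-∷ʳ (suc n))) ⟩
    prodB (map linearFactor (upTo (suc n) ++ [ suc n ]))
      ≡⟨ P.cong prodB (map-++ linearFactor (upTo (suc n)) [ suc n ]) ⟩
    prodB (map linearFactor (upTo (suc n)) ++ [ linearFactor (suc n) ])
      ≈⟨ prodB-++ (map linearFactor (upTo (suc n))) [ linearFactor (suc n) ] ⟩
    denom n *B (linearFactor (suc n) *B oneB)
      ≈⟨ *B-congˡ (denom n) (B.*-identityʳ (linearFactor (suc n))) ⟩
    denom n *B linearFactor (suc n) ∎
    where open ≑-Reasoning

  linearFactor-constant : ∀ i → linearFactor i 0 ≐ oneS
  linearFactor-constant i zero    = P.refl
  linearFactor-constant i (suc d) = P.refl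

  linearFactor-*B-zero : ∀ i G → (linearFactor i *B G) 0 ≐ G 0
  linearFactor-*B-zero i G = Q.trans (Qᴾ.conv-constantTerm (linearFactor i) G)
    (Q.trans (*S-congʳ (G 0) (linearFactor-constant i)) (Q.*-identityˡ (G 0)))

  linearFactor-*B-suc : ∀ i G k → (linearFactor i *B G) (suc k) ≐ G (suc k) -S (qpow i *S G k)
  linearFactor-*B-suc i G k = begin
    (linearFactor i *B G) (suc k)
      ≡⟨ Qᴾ.conv-suc (linearFactor i) G k ⟩
    (linearFactor i 0 *S G (suc k)) +S Qᴾ.conv (linearFactor i ∘ suc) G k
      ≈⟨ Q.+-cong (Q.trans (*S-congʳ (G (suc k)) (linearFactor-constant i)) (Q.*-identityˡ (G (suc k))))
                  (Qᴾ.conv-constantˡ (linearFactor i ∘ suc) G (λ j d → P.refl) k) ⟩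
    G (suc k) +S (linearFactor i 1 *S G k)
      ≈⟨ +S-congˡ (G (suc k)) (Q.trans (*S-congʳ (G k) (Q.+-identityˡ (negS (qpow i)))) (Q.sym (-‿distribˡ-* (qpow i) (G k)))) ⟩
    G (suc k) -S (qpow i *S G k) ∎
    where open ≐-Reasoning

  qMultisetSeries : ℕ → BS
  qMultisetSeries n k = qMultiset k n

  linearFactor-*B-qMultisetSeries : ∀ n →
    linearFactor (suc n) *B qMultisetSeries (suc n) ≑ qMultisetSeries n
  linearFactor-*B-qMultisetSeries n zero =
    Q.trans (linearFactor-*B-zero (suc n) (qMultisetSeries (suc n)))
            (Q.trans (qMultiset-zeroˡ (suc n)) (Q.sym (qMultiset-zeroˡ n)))
  linearFactor-*B-qMultisetSeries n (suc k) =
    Q.trans (linearFactor-*B-suc (suc n) (qMultisetSeries (suc n)) k)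
            (x≐y+z⇒x-z≐y (qMultiset-pascal′ k n))

  linearFactor-*B-qMultisetSeries-zero : linearFactor 0 *B qMultisetSeries 0 ≑ oneB
  linearFactor-*B-qMultisetSeries-zero zero = linearFactor-*B-zero 0 (qMultisetSeries 0)
  linearFactor-*B-qMultisetSeries-zero (suc k) =
    Q.trans (linearFactor-*B-suc 0 (qMultisetSeries 0) k)
            (Q.trans (+S-congˡ oneS (Q.-‿cong (Q.trans (*S-congʳ oneS qpow-zero) (Q.*-identityˡ oneS))))
                     (Q.-‿inverseʳ oneS))

  denom*B-qMultisetSeries : ∀ n → denom n *B qMultisetSeries n ≑ oneB
  denom*B-qMultisetSeries zero =
    B.trans (*B-congʳ (qMultisetSeries 0) (B.*-identityʳ (linearFactor 0))) linearFactor-*B-qMultisetSeries-zero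
  denom*B-qMultisetSeries (suc n) = begin
    denom (suc n) *B G (suc n)                        ≈⟨ *B-congʳ (G (suc n)) (denom-suc n) ⟩
    (denom n *B linearFactor (suc n)) *B G (suc n)    ≈⟨ B.*-assoc (denom n) (linearFactor (suc n)) (G (suc n)) ⟩
    denom n *B (linearFactor (suc n) *B G (suc n))    ≈⟨ *B-congˡ (denom n) (linearFactor-*B-qMultisetSeries n) ⟩
    denom n *B G n                                    ≈⟨ denom*B-qMultisetSeries n ⟩
    oneB                                              ∎
    where
    open ≑-Reasoning
    G = qMultisetSeries

  denom-constant : ∀ n → denom n 0 ≐ oneS
  denom-constant n = prodB-constant (map linearFactor (upTo (suc n))) factor-constant
    where
    factor-constant : ∀ x → x ∈ map linearFactor (upTo (suc n)) → x 0 ≐ oneS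
    factor-constant x x∈ with ∈-map⁻ linearFactor {xs = upTo (suc n)} x∈
    ... | i , _ , P.refl = linearFactor-constant i

  qMultisetSeries≑invB-denom : ∀ n → qMultisetSeries n ≑ invB (denom n)
  qMultisetSeries≑invB-denom n =
    invB-unique (denom n) (qMultisetSeries n) (denom-constant n) (denom*B-qMultisetSeries n)


module Descents where

  open import Data.List.Properties using (length-map)

  desFrom-suc : ∀ i w → desFrom (suc i) w ≡ map suc (desFrom i w)
  desFrom-suc i []          = P.refl
  desFrom-suc i (a ∷ [])    = P.refl
  desFrom-suc i (a ∷ b ∷ w) with b <ᵇ a | desFrom-suc (suc i) (b ∷ w)
  ... | true  | shifted = P.cong (suc i ∷_) shifted
  ... | false | shifted = shifted

  sum-map-suc : ∀ xs → sum (map suc xs) ≡ sum xs ℕ.+ length xs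
  sum-map-suc []       = P.refl
  sum-map-suc (x ∷ xs) = P.trans (P.cong suc (P.trans (P.cong (x ℕ.+_) (sum-map-suc xs)) (P.sym (ℕP.+-assoc x _ _))))
                                 (P.sym (ℕP.+-suc (x ℕ.+ sum xs) (length xs)))

  length-desFrom-suc : ∀ i w → length (desFrom (suc i) w) ≡ length (desFrom i w)
  length-desFrom-suc i w = P.trans (P.cong length (desFrom-suc i w)) (length-map suc (desFrom i w))

  sum-desFrom-suc : ∀ i w → sum (desFrom (suc i) w) ≡ sum (desFrom i w) ℕ.+ length (desFrom i w)
  sum-desFrom-suc i w = P.trans (P.cong sum (desFrom-suc i w)) (sum-map-suc (desFrom i w))

  des-∷-∷ : ∀ p a w → des (p ∷ a ∷ w) ≡ (if a <ᵇ p then suc (des (a ∷ w)) else des (a ∷ w))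
  des-∷-∷ p a w with a <ᵇ p
  ... | true  = P.cong suc (length-desFrom-suc 1 (a ∷ w))
  ... | false = length-desFrom-suc 1 (a ∷ w)

  -- Prepending a letter moves every descent one place right and possibly adds one at 1.
  maj-∷ : ∀ a w → maj (a ∷ w) ≡ maj w ℕ.+ des (a ∷ w)
  maj-∷ a []      = P.refl
  maj-∷ a (b ∷ w) with b <ᵇ a
  ... | true  = P.trans (P.cong suc (sum-desFrom-suc 1 (b ∷ w)))
                  (P.trans (P.sym (ℕP.+-suc (maj (b ∷ w)) _))
                           (P.cong (λ n → maj (b ∷ w) ℕ.+ suc n) (P.sym (length-desFrom-suc 1 (b ∷ w)))))
  ... | false = P.trans (sum-desFrom-suc 1 (b ∷ w))
                        (P.cong (maj (b ∷ w) ℕ.+_) (P.sym (length-desFrom-suc 1 (b ∷ w))))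


module CompatibleSums where

  open QSeries
  open Qᴾ using (∑; ∑ᴸ)
  open Descents
  open import Relation.Binary.Reasoning.Setoid Q.setoid
  open import Algebra.Properties.CommutativeSemigroup Q.*-commutativeSemigroup
    using () renaming (x∙yz≈y∙xz to *-x∙yz≈y∙xz)

  iverson : Bool → PS → PS
  iverson b x = if b then x else zeroS

  iverson-*ˡ : ∀ b x y → iverson b x *S y ≐ x *S iverson b y
  iverson-*ˡ true  x y = Q.refl {x *S y}
  iverson-*ˡ false x y = Q.trans (Q.zeroˡ y) (Q.sym (Q.zeroʳ x))

  iverson-*ʳ : ∀ b x y → iverson b (x *S y) ≐ x *S iverson b y
  iverson-*ʳ true  x y = Q.refl {x *S y}
  iverson-*ʳ false x y = Q.sym (Q.zeroʳ x)

  -- The analogue of qMultiset for multisets with entries below N.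
  qMultiset< : ℕ → ℕ → PS
  qMultiset< zero    zero    = oneS
  qMultiset< zero    (suc _) = zeroS
  qMultiset< (suc N) m       = qMultiset N m

  qMultiset<-suc : ∀ N m → qMultiset< (suc N) (suc m) ≐ qMultiset< N (suc m) +S (qpow N *S qMultiset N m)
  qMultiset<-suc zero m = Q.trans (Q.+-identityʳ (qpow 0 *S qMultiset 0 m)) (Q.sym (Q.+-identityˡ _))
  qMultiset<-suc (suc N) m = qMultiset-pascal N m

  ∑-qMultiset< : ∀ K c m →
    ∑ K (λ j → qpow j *S qMultiset< (suc j ∸ c) (suc m)) ≐ qpow c *S qMultiset< (K ∸ c) (suc (suc m))
  ∑-qMultiset< zero c m = begin
    zeroS                                  ≈⟨ Q.sym (Q.zeroʳ (qpow c)) ⟩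
    qpow c *S zeroS                        ≡⟨ P.cong (λ N → qpow c *S qMultiset< N (suc (suc m))) (P.sym (ℕP.0∸n≡0 c)) ⟩
    qpow c *S qMultiset< (0 ∸ c) (suc (suc m)) ∎
  ∑-qMultiset< (suc K) c m with c ≤? K
  ... | yes c≤K = begin
    ∑ (suc K) g                                       ≈⟨ Qᴾ.∑-sucʳ K g ⟩
    ∑ K g +S g K                                      ≈⟨ Q.+-cong (∑-qMultiset< K c m) lastTerm ⟩
    (qpow c *S R N) +S (qpow c *S (qpow N *S qMultiset N (suc m)))
                                                      ≈⟨ Q.sym (Q.distribˡ (qpow c) (R N) _) ⟩
    qpow c *S (R N +S (qpow N *S qMultiset N (suc m))) ≈⟨ *S-congˡ (qpow c) (Q.sym (qMultiset<-suc N (suc m))) ⟩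
    qpow c *S R (suc N)                               ≡⟨ P.cong (λ N → qpow c *S R N) (P.sym (ℕP.+-∸-assoc 1 c≤K)) ⟩
    qpow c *S R (suc K ∸ c)                           ∎
    where
    N = K ∸ c
    R = λ N → qMultiset< N (suc (suc m))
    g = λ j → qpow j *S qMultiset< (suc j ∸ c) (suc m)
    lastTerm : g K ≐ qpow c *S (qpow N *S qMultiset N (suc m))
    lastTerm = begin
      qpow K *S qMultiset< (suc K ∸ c) (suc m)   ≡⟨ P.cong (λ N → qpow K *S qMultiset< N (suc m)) (ℕP.+-∸-assoc 1 c≤K) ⟩
      qpow K *S qMultiset N (suc m)              ≡⟨ P.cong (λ n → qpow n *S qMultiset N (suc m)) (P.sym (ℕP.m+[n∸m]≡n c≤K)) ⟩
      qpow (c ℕ.+ N) *S qMultiset N (suc m)      ≈⟨ *S-congʳ (qMultiset N (suc m)) (qpow-+ c N) ⟩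
      (qpow c *S qpow N) *S qMultiset N (suc m)  ≈⟨ Q.*-assoc (qpow c) (qpow N) (qMultiset N (suc m)) ⟩
      qpow c *S (qpow N *S qMultiset N (suc m))  ∎
  ... | no c≰K = begin
    ∑ (suc K) g                                           ≈⟨ Qᴾ.∑-sucʳ K g ⟩
    ∑ K g +S g K                                          ≈⟨ Q.+-cong (∑-qMultiset< K c m) (*S-congˡ (qpow K) (vanishes K<c)) ⟩
    (qpow c *S qMultiset< (K ∸ c) (suc (suc m))) +S (qpow K *S zeroS)
                                                          ≈⟨ Q.+-cong (*S-congˡ (qpow c) (vanishes (ℕP.<⇒≤ K<c))) (Q.zeroʳ (qpow K)) ⟩
    (qpow c *S zeroS) +S zeroS                            ≈⟨ Q.+-identityʳ (qpow c *S zeroS) ⟩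
    qpow c *S zeroS                                       ≈⟨ *S-congˡ (qpow c) (Q.sym (vanishes K<c)) ⟩
    qpow c *S qMultiset< (suc K ∸ c) (suc (suc m))        ∎
    where
    g = λ j → qpow j *S qMultiset< (suc j ∸ c) (suc m)
    K<c : K < c
    K<c = ℕP.≰⇒> c≰K
    vanishes : ∀ {N n} → N ≤ c → qMultiset< (N ∸ c) (suc n) ≐ zeroS
    vanishes N≤c rewrite ℕP.m≤n⇒m∸n≡0 N≤c = Q.refl {zeroS}

  bound : ℕ → ℕ → ℕ → ℕ
  bound p a k = if a <ᵇ p then k else suc k

  -- Sum of q^(f₁+⋯+fₙ) over k ≥ f₁ ≥ ⋯ ≥ fₙ ≥ 0 with fᵢ > fᵢ₊₁ whenever wᵢ > wᵢ₊₁,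
  -- and f₁ < k when w₁ < p (the P-partitions of the chain w, read after p).
  compatibleSum : ℕ → ℕ → List ℕ → PS
  compatibleSum p k []      = oneS
  compatibleSum p k (a ∷ w) = ∑ (bound p a k) (λ j → qpow j *S compatibleSum a j w)

  bound-∸-des : ∀ p a w k → bound p a k ∸ des (a ∷ w) ≡ suc k ∸ des (p ∷ a ∷ w)
  bound-∸-des p a w k rewrite des-∷-∷ p a w with a <ᵇ p
  ... | true  = P.refl
  ... | false = P.refl

  compatibleSum-∷ : ∀ p k a w →
    compatibleSum p k (a ∷ w) ≐ qpow (maj (a ∷ w)) *S qMultiset< (suc k ∸ des (p ∷ a ∷ w)) (suc (length w))
  compatibleSum-∷ p k a [] = begin
    ∑ (bound p a k) (λ j → qpow j *S oneS)   ≈⟨ geometric (bound p a k) ⟩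
    qMultiset< (bound p a k) 1              ≡⟨ P.cong (λ N → qMultiset< N 1) (bound-∸-des p a [] k) ⟩
    qMultiset< (suc k ∸ des (p ∷ a ∷ [])) 1 ≈⟨ Q.sym (Q.trans (*S-congʳ S qpow-zero) (Q.*-identityˡ S)) ⟩
    qpow 0 *S qMultiset< (suc k ∸ des (p ∷ a ∷ [])) 1 ∎
    where
    S = qMultiset< (suc k ∸ des (p ∷ a ∷ [])) 1
    geometric : ∀ N → ∑ N (λ j → qpow j *S oneS) ≐ qMultiset< N 1
    geometric zero    _ = P.refl
    geometric (suc N)   = Q.refl {qMultiset N 1}
  compatibleSum-∷ p k a (b ∷ w) = begin
    ∑ K (λ j → qpow j *S compatibleSum a j (b ∷ w))
      ≈⟨ Qᴾ.∑-cong K (λ j _ → *S-congˡ (qpow j) (compatibleSum-∷ a j b w)) ⟩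
    ∑ K (λ j → qpow j *S (qpow M *S R j))
      ≈⟨ Qᴾ.∑-cong K (λ j _ → *-x∙yz≈y∙xz (qpow j) (qpow M) (R j)) ⟩
    ∑ K (λ j → qpow M *S (qpow j *S R j))
      ≈⟨ Q.sym (Qᴾ.∑-*ˡ K (qpow M) (λ j → qpow j *S R j)) ⟩
    qpow M *S ∑ K (λ j → qpow j *S R j)
      ≈⟨ *S-congˡ (qpow M) (∑-qMultiset< K c (length w)) ⟩
    qpow M *S (qpow c *S qMultiset< (K ∸ c) (suc (suc (length w))))
      ≈⟨ Q.sym (Q.*-assoc (qpow M) (qpow c) (qMultiset< (K ∸ c) (suc (suc (length w))))) ⟩
    (qpow M *S qpow c) *S qMultiset< (K ∸ c) (suc (suc (length w)))
      ≈⟨ *S-congʳ (qMultiset< (K ∸ c) (suc (suc (length w)))) (Q.sym (qpow-+ M c)) ⟩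
    qpow (M ℕ.+ c) *S qMultiset< (K ∸ c) (suc (suc (length w)))
      ≡⟨ P.cong₂ (λ n N → qpow n *S qMultiset< N (suc (suc (length w)))) (P.sym (maj-∷ a (b ∷ w))) (bound-∸-des p a (b ∷ w) k) ⟩
    qpow (maj (a ∷ b ∷ w)) *S qMultiset< (suc k ∸ des (p ∷ a ∷ b ∷ w)) (suc (length (b ∷ w))) ∎
    where
    K = bound p a k
    M = maj (b ∷ w)
    c = des (a ∷ b ∷ w)
    R = λ j → qMultiset< (suc j ∸ c) (suc (length w))

  ∑-pick : ∀ k d (H : ℕ → PS) → H 0 ≐ zeroS →
    ∑ (suc k) (λ j → iverson (d ≡ᵇ j) (H (suc (k ∸ j)))) ≐ H (suc k ∸ d)
  ∑-pick k zero H H₀≐0 = begin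
    ∑ (suc k) (λ j → iverson (0 ≡ᵇ j) (H (suc (k ∸ j))))  ≡⟨ Qᴾ.∑-suc k (λ j → iverson (0 ≡ᵇ j) (H (suc (k ∸ j)))) ⟩
    H (suc k) +S ∑ k (λ _ → zeroS)                        ≈⟨ +S-congˡ (H (suc k)) (Qᴾ.∑-zero k) ⟩
    H (suc k) +S zeroS                                    ≈⟨ Q.+-identityʳ (H (suc k)) ⟩
    H (suc k)                                             ∎
  ∑-pick zero (suc d) H H₀≐0 = Q.trans (Q.+-identityʳ zeroS)
    (Q.sym (Q.trans (λ e → P.cong (λ n → H n e) (ℕP.0∸n≡0 d)) H₀≐0))
  ∑-pick (suc k) (suc d) H H₀≐0 = begin
    ∑ (suc (suc k)) (λ j → iverson (suc d ≡ᵇ j) (H (suc (suc k ∸ j))))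
      ≡⟨ Qᴾ.∑-suc (suc k) (λ j → iverson (suc d ≡ᵇ j) (H (suc (suc k ∸ j)))) ⟩
    zeroS +S ∑ (suc k) (λ j → iverson (d ≡ᵇ j) (H (suc (k ∸ j))))
      ≈⟨ Q.+-identityˡ _ ⟩
    ∑ (suc k) (λ j → iverson (d ≡ᵇ j) (H (suc (k ∸ j))))
      ≈⟨ ∑-pick k d H H₀≐0 ⟩
    H (suc k ∸ d) ∎

  compatibleSum-zero : ∀ w k n → length w ≡ n →
    compatibleSum 0 k w ≐ ∑ (suc k) (λ j → iverson (des w ≡ᵇ j) (qpow (maj w)) *S qMultiset (k ∸ j) n)
  compatibleSum-zero w k n |w|≡n = Q.sym (begin
    ∑ (suc k) (λ j → iverson (des w ≡ᵇ j) (qpow (maj w)) *S qMultiset (k ∸ j) n)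
      ≈⟨ Qᴾ.∑-cong (suc k) (λ j _ → iverson-*ˡ (des w ≡ᵇ j) (qpow (maj w)) (qMultiset (k ∸ j) n)) ⟩
    ∑ (suc k) (λ j → qpow (maj w) *S iverson (des w ≡ᵇ j) (qMultiset (k ∸ j) n))
      ≈⟨ Q.sym (Qᴾ.∑-*ˡ (suc k) (qpow (maj w)) (λ j → iverson (des w ≡ᵇ j) (qMultiset (k ∸ j) n))) ⟩
    qpow (maj w) *S ∑ (suc k) (λ j → iverson (des w ≡ᵇ j) (qMultiset (k ∸ j) n))
      ≈⟨ pick w |w|≡n ⟩
    compatibleSum 0 k w ∎)
    where
    emptyCount : ℕ → PS
    emptyCount zero    = zeroS
    emptyCount (suc _) = oneS
    pick : ∀ w → length w ≡ n →
      qpow (maj w) *S ∑ (suc k) (λ j → iverson (des w ≡ᵇ j) (qMultiset (k ∸ j) n)) ≐ compatibleSum 0 k w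
    pick [] P.refl = Q.trans (*S-congˡ (qpow 0) (∑-pick k 0 emptyCount (Q.refl {zeroS})))
                             (Q.trans (*S-congʳ oneS qpow-zero) (Q.*-identityˡ oneS))
    pick (a ∷ w) P.refl = Q.trans
      (*S-congˡ (qpow (maj (a ∷ w))) (∑-pick k (des (a ∷ w)) (λ N → qMultiset< N (suc (length w))) (Q.refl {zeroS})))
      (Q.sym (Q.trans (compatibleSum-∷ 0 k a w)
        (Q.reflexive (P.cong (λ n → qpow (maj (a ∷ w)) *S qMultiset< (suc k ∸ n) (suc (length w))) (des-∷-∷ 0 a w)))))


module Content where

  open import Data.List using (zipWith)
  open import Data.Bool.ListAction using (and)
  open import Data.Empty using (⊥-elim)

  hasContentFrom : ℕ → List ℕ → List ℕ → Bool
  hasContentFrom i []      w = true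
  hasContentFrom i (e ∷ η) w = (count i w ≡ᵇ e) ∧ hasContentFrom (suc i) η w

  hasLetter : ℕ → ℕ → List ℕ → Bool
  hasLetter i a []      = false
  hasLetter i a (e ∷ η) = if i ≡ᵇ a then 1 ≤ᵇ e else hasLetter (suc i) a η

  removeLetter : ℕ → ℕ → List ℕ → List ℕ
  removeLetter i a []      = []
  removeLetter i a (e ∷ η) = if i ≡ᵇ a then (e ∸ 1) ∷ η else e ∷ removeLetter (suc i) a η

  ≡ᵇ-refl : ∀ n → (n ≡ᵇ n) ≡ true
  ≡ᵇ-refl n = dec-true (n ≟ n) P.refl

  hasContent≡hasContentFrom : ∀ η w → hasContent η w ≡ hasContentFrom 1 η w
  hasContent≡hasContentFrom η w =
    P.trans (P.cong (λ l → and (zipWith (λ j e → count j w ≡ᵇ e) l η)) (map-upTo suc (length η)))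
            (shifted η 1 suc (λ x → ℕP.+-comm 1 x))
    where
    shifted : ∀ η i (g : ℕ → ℕ) → (∀ x → g x ≡ x ℕ.+ i) →
      and (zipWith (λ j e → count j w ≡ᵇ e) (applyUpTo g (length η)) η) ≡ hasContentFrom i η w
    shifted []      i g g≡ = P.refl
    shifted (e ∷ η) i g g≡ = P.cong₂ _∧_ (P.cong (λ j → count j w ≡ᵇ e) (g≡ 0))
      (shifted η (suc i) (g ∘ suc) (λ x → P.trans (g≡ (suc x)) (P.sym (ℕP.+-suc x i))))

  hasContentFrom-∷-below : ∀ η j a w → a < j → hasContentFrom j η (a ∷ w) ≡ hasContentFrom j η w
  hasContentFrom-∷-below []      j a w a<j = P.refl
  hasContentFrom-∷-below (e ∷ η) j a w a<j rewrite dec-false (a ≟ j) (ℕP.<⇒≢ a<j) =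
    P.cong ((count j w ≡ᵇ e) ∧_) (hasContentFrom-∷-below η (suc j) a w (ℕP.m≤n⇒m≤1+n a<j))

  ∧-swap : ∀ x y z → x ∧ (y ∧ z) ≡ y ∧ (x ∧ z)
  ∧-swap true  y z = P.refl
  ∧-swap false true  z = P.refl
  ∧-swap false false z = P.refl

  hasContentFrom-∷ : ∀ η i a w → i ≤ a → a < i ℕ.+ length η →
    hasContentFrom i η (a ∷ w) ≡ hasLetter i a η ∧ hasContentFrom i (removeLetter i a η) w
  hasContentFrom-∷ [] i a w i≤a a<i+0 =
    ⊥-elim (ℕP.<⇒≱ (P.subst (a <_) (ℕP.+-identityʳ i) a<i+0) i≤a)
  hasContentFrom-∷ (e ∷ η) i a w i≤a a<i+|η| with i ≟ a
  ... | yes P.refl rewrite ≡ᵇ-refl i | hasContentFrom-∷-below η (suc i) i w ℕP.≤-refl = firstCount e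
    where
    firstCount : ∀ e → (suc (count i w) ≡ᵇ e) ∧ hasContentFrom (suc i) η w
                       ≡ (1 ≤ᵇ e) ∧ hasContentFrom i ((e ∸ 1) ∷ η) w
    firstCount zero    = P.refl
    firstCount (suc e) = P.refl
  ... | no i≢a rewrite dec-false (i ≟ a) i≢a | dec-false (a ≟ i) (i≢a ∘ P.sym) =
    P.trans (P.cong ((count i w ≡ᵇ e) ∧_)
                    (hasContentFrom-∷ η (suc i) a w (ℕP.≤∧≢⇒< i≤a i≢a) (P.subst (a <_) (ℕP.+-suc i (length η)) a<i+|η|)))
            (∧-swap (count i w ≡ᵇ e) (hasLetter (suc i) a η) _)

  sum-removeLetter : ∀ η i a → hasLetter i a η ≡ true → suc (sum (removeLetter i a η)) ≡ sum η
  sum-removeLetter []      i a ()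
  sum-removeLetter (e ∷ η) i a present with i ≡ᵇ a
  sum-removeLetter (zero  ∷ η) i a () | true
  sum-removeLetter (suc e ∷ η) i a present | true = P.refl
  ... | false = P.trans (P.sym (ℕP.+-suc e _)) (P.cong (e ℕ.+_) (sum-removeLetter η (suc i) a present))

  length-removeLetter : ∀ η i a → length (removeLetter i a η) ≡ length η
  length-removeLetter []      i a = P.refl
  length-removeLetter (e ∷ η) i a with i ≡ᵇ a
  ... | true  = P.refl
  ... | false = P.cong suc (length-removeLetter η (suc i) a)


module BoundedProducts where

  open QSeries
  open Qᴾ using (∑)
  open EhrhartSide using (qMultisetProduct)
  open CompatibleSums using (iverson; qMultiset<)
  open Content using (hasLetter; removeLetter; ≡ᵇ-refl)
  import Data.Bool.Properties as 𝔹P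
  open import Relation.Binary.Reasoning.Setoid Q.setoid
  open import Algebra.Properties.CommutativeSemigroup Q.*-commutativeSemigroup
    using () renaming (x∙yz≈y∙xz to *-x∙yz≈y∙xz)

  -- η lists the multiplicities of the letters i, i+1, …; a letter below p
  -- contributes multisets with entries below k, any other letter entries ≤ k.
  boundedProduct : ℕ → ℕ → ℕ → List ℕ → PS
  boundedProduct i p k []      = oneS
  boundedProduct i p k (e ∷ η) = (if i <ᵇ p then qMultiset< k e else qMultiset k e) *S boundedProduct (suc i) p k η

  qMultiset<Product : ℕ → List ℕ → PS
  qMultiset<Product k η = foldr (λ e s → qMultiset< k e *S s) oneS η

  -- The part of boundedProduct i p k η in which a is the smallest letter attaining k.
  maxTerm : ℕ → ℕ → ℕ → List ℕ → ℕ → PS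
  maxTerm i p k η a = iverson (hasLetter i a η ∧ not (a <ᵇ p)) (qpow k *S boundedProduct i a k (removeLetter i a η))

  qMultiset-splitTop : ∀ k e → qMultiset k e ≐ qMultiset< k e +S iverson (1 ≤ᵇ e) (qpow k *S qMultiset k (e ∸ 1))
  qMultiset-splitTop zero    zero    = Q.sym (Q.+-identityʳ oneS)
  qMultiset-splitTop (suc k) zero    = Q.sym (Q.+-identityʳ oneS)
  qMultiset-splitTop zero    (suc e) = begin
    qMultiset 0 (suc e)         ≈⟨ qMultiset-zeroˡ (suc e) ⟩
    oneS                        ≈⟨ Q.sym (Q.trans (*S-congʳ (qMultiset 0 e) qpow-zero)
                                        (Q.trans (Q.*-identityˡ (qMultiset 0 e)) (qMultiset-zeroˡ e))) ⟩
    qpow 0 *S qMultiset 0 e     ≈⟨ Q.sym (Q.+-identityˡ (qpow 0 *S qMultiset 0 e)) ⟩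
    zeroS +S (qpow 0 *S qMultiset 0 e) ∎
  qMultiset-splitTop (suc k) (suc e) = qMultiset-pascal k e

  boundedProduct-≥ : ∀ η j p k → p ≤ j → boundedProduct j p k η ≐ qMultisetProduct k η
  boundedProduct-≥ []      j p k p≤j = Q.refl {oneS}
  boundedProduct-≥ (e ∷ η) j p k p≤j rewrite dec-false (j <? p) (ℕP.≤⇒≯ p≤j) =
    *S-congˡ (qMultiset k e) (boundedProduct-≥ η (suc j) p k (ℕP.m≤n⇒m≤1+n p≤j))

  maxTerm-∷ : ∀ i p k e η a → i < a → maxTerm i p k (e ∷ η) a ≐ qMultiset< k e *S maxTerm (suc i) p k η a
  maxTerm-∷ i p k e η a i<a rewrite dec-false (i ≟ a) (ℕP.<⇒≢ i<a) | dec-true (i <? a) i<a =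
    iverson-swap (hasLetter (suc i) a η ∧ not (a <ᵇ p))
    where
    X = qpow k
    Y = qMultiset< k e
    Z = boundedProduct (suc i) a k (removeLetter (suc i) a η)
    iverson-swap : ∀ b → iverson b (X *S (Y *S Z)) ≐ Y *S iverson b (X *S Z)
    iverson-swap true  = *-x∙yz≈y∙xz X Y Z
    iverson-swap false = Q.sym (Q.zeroʳ Y)

  maxTerm-self : ∀ i p k e η →
    maxTerm i p k (e ∷ η) i ≡ iverson ((1 ≤ᵇ e) ∧ not (i <ᵇ p)) (qpow k *S (qMultiset k (e ∸ 1) *S boundedProduct (suc i) i k η))
  maxTerm-self i p k e η rewrite ≡ᵇ-refl i | dec-false (i <? i) (ℕP.<-irrefl P.refl) = P.refl

  boundedProduct-∷ : ∀ i p k e η →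
    boundedProduct i p k (e ∷ η) ≐ (qMultiset< k e *S boundedProduct (suc i) p k η) +S maxTerm i p k (e ∷ η) i
  boundedProduct-∷ i p k e η rewrite maxTerm-self i p k e η with i <ᵇ p in i<ᵇp
  ... | true = Q.sym (Q.trans (+S-congˡ (qMultiset< k e *S boundedProduct (suc i) p k η)
                                        (λ d → P.cong (λ b → iverson b X d) (𝔹P.∧-zeroʳ (1 ≤ᵇ e))))
                              (Q.+-identityʳ (qMultiset< k e *S boundedProduct (suc i) p k η)))
    where X = qpow k *S (qMultiset k (e ∸ 1) *S boundedProduct (suc i) i k η)
  ... | false = begin
    qMultiset k e *S boundedProduct (suc i) p k η
      ≈⟨ Q.*-cong (qMultiset-splitTop k e) (boundedProduct-≥ η (suc i) p k p≤si) ⟩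
    (qMultiset< k e +S iverson (1 ≤ᵇ e) top) *S Π
      ≈⟨ Q.distribʳ Π (qMultiset< k e) (iverson (1 ≤ᵇ e) top) ⟩
    (qMultiset< k e *S Π) +S (iverson (1 ≤ᵇ e) top *S Π)
      ≈⟨ Q.+-cong (*S-congˡ (qMultiset< k e) (Q.sym (boundedProduct-≥ η (suc i) p k p≤si))) (topTerm (1 ≤ᵇ e)) ⟩
    (qMultiset< k e *S boundedProduct (suc i) p k η)
      +S iverson ((1 ≤ᵇ e) ∧ true) (qpow k *S (qMultiset k (e ∸ 1) *S boundedProduct (suc i) i k η)) ∎
    where
    Π = qMultisetProduct k η
    top = qpow k *S qMultiset k (e ∸ 1)
    p≤si : p ≤ suc i
    p≤si = ℕP.m≤n⇒m≤1+n (ℕP.≮⇒≥ (λ i<p → P.subst T i<ᵇp (ℕP.<⇒<ᵇ i<p)))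
    topTerm : ∀ b → iverson b top *S Π ≐ iverson (b ∧ true) (qpow k *S (qMultiset k (e ∸ 1) *S boundedProduct (suc i) i k η))
    topTerm true  = Q.trans (Q.*-assoc (qpow k) (qMultiset k (e ∸ 1)) Π)
                            (*S-congˡ (qpow k) (*S-congˡ (qMultiset k (e ∸ 1)) (Q.sym (boundedProduct-≥ η (suc i) i k (ℕP.n≤1+n i)))))
    topTerm false = Q.zeroˡ Π

  ∑-maxTerm-∷ : ∀ i p k e η →
    ∑ (suc (length η)) (λ x → maxTerm i p k (e ∷ η) (x ℕ.+ i))
      ≐ maxTerm i p k (e ∷ η) i +S (qMultiset< k e *S ∑ (length η) (λ x → maxTerm (suc i) p k η (x ℕ.+ suc i)))
  ∑-maxTerm-∷ i p k e η = begin
    ∑ (suc L) (λ x → maxTerm i p k (e ∷ η) (x ℕ.+ i))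
      ≡⟨ Qᴾ.∑-suc L (λ x → maxTerm i p k (e ∷ η) (x ℕ.+ i)) ⟩
    maxTerm i p k (e ∷ η) i +S ∑ L (λ x → maxTerm i p k (e ∷ η) (suc x ℕ.+ i))
      ≈⟨ +S-congˡ (maxTerm i p k (e ∷ η) i) (Qᴾ.∑-cong L (λ x _ → later x)) ⟩
    maxTerm i p k (e ∷ η) i +S ∑ L (λ x → qMultiset< k e *S maxTerm (suc i) p k η (x ℕ.+ suc i))
      ≈⟨ +S-congˡ (maxTerm i p k (e ∷ η) i) (Q.sym (Qᴾ.∑-*ˡ L (qMultiset< k e) (λ x → maxTerm (suc i) p k η (x ℕ.+ suc i)))) ⟩
    maxTerm i p k (e ∷ η) i +S (qMultiset< k e *S ∑ L (λ x → maxTerm (suc i) p k η (x ℕ.+ suc i))) ∎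
    where
    L = length η
    later : ∀ x → maxTerm i p k (e ∷ η) (suc x ℕ.+ i) ≐ qMultiset< k e *S maxTerm (suc i) p k η (x ℕ.+ suc i)
    later x = Q.trans (maxTerm-∷ i p k e η (suc x ℕ.+ i) (s≤s (ℕP.m≤n+m i x)))
                      (Q.reflexive (P.cong (λ a → qMultiset< k e *S maxTerm (suc i) p k η a) (P.sym (ℕP.+-suc x i))))

  -- Expansion by the smallest letter, if any, that attains the value k.
  boundedProduct-expand : ∀ η i p k →
    boundedProduct i p k η ≐ qMultiset<Product k η +S ∑ (length η) (λ x → maxTerm i p k η (x ℕ.+ i))
  boundedProduct-expand []      i p k = Q.sym (Q.+-identityʳ oneS)
  boundedProduct-expand (e ∷ η) i p k = begin
    boundedProduct i p k (e ∷ η)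
      ≈⟨ boundedProduct-∷ i p k e η ⟩
    (B *S boundedProduct (suc i) p k η) +S T₀
      ≈⟨ +S-congʳ T₀ (*S-congˡ B (boundedProduct-expand η (suc i) p k)) ⟩
    (B *S (qMultiset<Product k η +S S)) +S T₀
      ≈⟨ +S-congʳ T₀ (Q.distribˡ B (qMultiset<Product k η) S) ⟩
    ((B *S qMultiset<Product k η) +S (B *S S)) +S T₀
      ≈⟨ Q.+-assoc (B *S qMultiset<Product k η) (B *S S) T₀ ⟩
    (B *S qMultiset<Product k η) +S ((B *S S) +S T₀)
      ≈⟨ +S-congˡ (B *S qMultiset<Product k η) (Q.+-comm (B *S S) T₀) ⟩
    (B *S qMultiset<Product k η) +S (T₀ +S (B *S S))
      ≈⟨ +S-congˡ (B *S qMultiset<Product k η) (Q.sym (∑-maxTerm-∷ i p k e η)) ⟩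
    qMultiset<Product k (e ∷ η) +S ∑ (suc (length η)) (λ x → maxTerm i p k (e ∷ η) (x ℕ.+ i)) ∎
    where
    B = qMultiset< k e
    T₀ = maxTerm i p k (e ∷ η) i
    S = ∑ (length η) (λ x → maxTerm (suc i) p k η (x ℕ.+ suc i))


module ContentSums where

  open QSeries
  open Qᴾ using (∑; ∑ᴸ)
  open EhrhartSide using (qMultisetProduct)
  open CompatibleSums
  open Content
  open BoundedProducts
  open import Relation.Binary.Reasoning.Setoid Q.setoid

  iverson-cong : ∀ b {x y} → x ≐ y → iverson b x ≐ iverson b y
  iverson-cong true  x≐y = x≐y
  iverson-cong false _   = Q.refl {zeroS}

  iverson-+ : ∀ b x y → iverson b (x +S y) ≐ iverson b x +S iverson b y
  iverson-+ true  x y = Q.refl {x +S y}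
  iverson-+ false x y = Q.sym (Q.+-identityʳ zeroS)

  iverson-∧ : ∀ b c d x → iverson (b ∧ c) (iverson d x) ≡ iverson (b ∧ d) (iverson c x)
  iverson-∧ false c     d     x = P.refl
  iverson-∧ true  true  true  x = P.refl
  iverson-∧ true  true  false x = P.refl
  iverson-∧ true  false true  x = P.refl
  iverson-∧ true  false false x = P.refl

  ∑ᴸ-iverson : ∀ {A : Set} (xs : List A) b f → ∑ᴸ xs (λ w → iverson b (f w)) ≐ iverson b (∑ᴸ xs f)
  ∑ᴸ-iverson xs true  f = Q.refl {∑ᴸ xs f}
  ∑ᴸ-iverson xs false f = Qᴾ.∑ᴸ-zero xs

  ∑ᴸ-words-suc : ∀ r n F → ∑ᴸ (words r (suc n)) F ≐ ∑ r (λ x → ∑ᴸ (words r n) (λ w → F (suc x ∷ w)))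
  ∑ᴸ-words-suc r n F = begin
    ∑ᴸ (concatMap (λ a → map (a ∷_) (words r n)) (map suc (upTo r))) F
      ≈⟨ Qᴾ.∑ᴸ-concatMap (λ a → map (a ∷_) (words r n)) (map suc (upTo r)) F ⟩
    ∑ᴸ (map suc (upTo r)) (λ a → ∑ᴸ (map (a ∷_) (words r n)) F)
      ≡⟨ Qᴾ.∑ᴸ-map suc (upTo r) (λ a → ∑ᴸ (map (a ∷_) (words r n)) F) ⟩
    ∑ᴸ (upTo r) (λ x → ∑ᴸ (map (suc x ∷_) (words r n)) F)
      ≈⟨ Qᴾ.∑ᴸ-cong (upTo r) (λ x → Q.reflexive (Qᴾ.∑ᴸ-map (suc x ∷_) (words r n) F)) ⟩
    ∑ r (λ x → ∑ᴸ (words r n) (λ w → F (suc x ∷ w))) ∎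

  ∑ᴸ-words-cong : ∀ r n F G → (∀ w → length w ≡ n → F w ≐ G w) → ∑ᴸ (words r n) F ≐ ∑ᴸ (words r n) G
  ∑ᴸ-words-cong r zero    F G F≐G = Q.+-cong (F≐G [] P.refl) (Q.refl {zeroS})
  ∑ᴸ-words-cong r (suc n) F G F≐G = begin
    ∑ᴸ (words r (suc n)) F                            ≈⟨ ∑ᴸ-words-suc r n F ⟩
    ∑ r (λ x → ∑ᴸ (words r n) (λ w → F (suc x ∷ w)))
      ≈⟨ Qᴾ.∑-cong r (λ x _ → ∑ᴸ-words-cong r n (λ w → F (suc x ∷ w)) (λ w → G (suc x ∷ w))
                                                (λ w |w|≡n → F≐G (suc x ∷ w) (P.cong suc |w|≡n))) ⟩
    ∑ r (λ x → ∑ᴸ (words r n) (λ w → G (suc x ∷ w)))  ≈⟨ Q.sym (∑ᴸ-words-suc r n G) ⟩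
    ∑ᴸ (words r (suc n)) G                            ∎

  compatibleSum-∷-zero : ∀ p a w → compatibleSum p 0 (a ∷ w) ≐ iverson (not (a <ᵇ p)) (qpow 0 *S compatibleSum a 0 w)
  compatibleSum-∷-zero p a w with a <ᵇ p
  ... | true  = Q.refl {zeroS}
  ... | false = Q.+-identityʳ (qpow 0 *S compatibleSum a 0 w)

  -- Split by whether the first value attains the bound.
  compatibleSum-∷-suc : ∀ p k a w →
    compatibleSum p (suc k) (a ∷ w) ≐ iverson (not (a <ᵇ p)) (qpow (suc k) *S compatibleSum a (suc k) w) +S compatibleSum 0 k (a ∷ w)
  compatibleSum-∷-suc p k a w with a <ᵇ p
  ... | true  = Q.sym (Q.+-identityˡ (compatibleSum 0 k (a ∷ w)))
  ... | false = Q.trans (Qᴾ.∑-sucʳ (suc k) (λ j → qpow j *S compatibleSum a j w))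
                        (Q.+-comm (∑ (suc k) (λ j → qpow j *S compatibleSum a j w)) _)

  contentSum : ℕ → ℕ → ℕ → List ℕ → ℕ → PS
  contentSum r p k η n = ∑ᴸ (words r n) (λ w → iverson (hasContentFrom 1 η w) (compatibleSum p k w))

  -- Words a ∷ w of content η whose first value is the top value K.
  topStartSum : ℕ → ℕ → ℕ → ℕ → List ℕ → ℕ → PS
  topStartSum r n p K η a =
    ∑ᴸ (words r n) (λ w → iverson (hasContentFrom 1 η (a ∷ w)) (iverson (not (a <ᵇ p)) (qpow K *S compatibleSum a K w)))

  topStartSum≐maxTerm : ∀ r n p K η x → x < r → length η ≡ r → sum η ≡ suc n →
    (∀ η′ → length η′ ≡ r → sum η′ ≡ n → contentSum r (suc x) K η′ n ≐ boundedProduct 1 (suc x) K η′) →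
    topStartSum r n p K η (suc x) ≐ maxTerm 1 p K η (suc x)
  topStartSum≐maxTerm r n p K η x x<r |η|≡r Ση≡1+n IH = begin
    ∑ᴸ (words r n) (λ w → iverson (hasContentFrom 1 η (a ∷ w)) (iverson ν (qpow K *S compatibleSum a K w)))
      ≈⟨ Qᴾ.∑ᴸ-cong (words r n) (λ w → Q.reflexive (P.cong (λ b → iverson b (iverson ν (qpow K *S compatibleSum a K w)))
           (hasContentFrom-∷ η 1 a w (s≤s z≤n) (s≤s (P.subst (x <_) (P.sym |η|≡r) x<r))))) ⟩
    ∑ᴸ (words r n) (λ w → iverson (π ∧ hasContentFrom 1 η′ w) (iverson ν (qpow K *S compatibleSum a K w)))
      ≈⟨ Qᴾ.∑ᴸ-cong (words r n) (λ w → Q.reflexive (iverson-∧ π (hasContentFrom 1 η′ w) ν (qpow K *S compatibleSum a K w))) ⟩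
    ∑ᴸ (words r n) (λ w → iverson (π ∧ ν) (iverson (hasContentFrom 1 η′ w) (qpow K *S compatibleSum a K w)))
      ≈⟨ Qᴾ.∑ᴸ-cong (words r n) (λ w → iverson-cong (π ∧ ν) (iverson-*ʳ (hasContentFrom 1 η′ w) (qpow K) (compatibleSum a K w))) ⟩
    ∑ᴸ (words r n) (λ w → iverson (π ∧ ν) (qpow K *S iverson (hasContentFrom 1 η′ w) (compatibleSum a K w)))
      ≈⟨ ∑ᴸ-iverson (words r n) (π ∧ ν) (λ w → qpow K *S iverson (hasContentFrom 1 η′ w) (compatibleSum a K w)) ⟩
    iverson (π ∧ ν) (∑ᴸ (words r n) (λ w → qpow K *S iverson (hasContentFrom 1 η′ w) (compatibleSum a K w)))
      ≈⟨ iverson-cong (π ∧ ν) (Q.sym (Qᴾ.∑ᴸ-*ˡ (words r n) (qpow K) (λ w → iverson (hasContentFrom 1 η′ w) (compatibleSum a K w)))) ⟩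
    iverson (π ∧ ν) (qpow K *S contentSum r a K η′ n)
      ≈⟨ byInduction ⟩
    maxTerm 1 p K η a ∎
    where
    a = suc x
    ν = not (a <ᵇ p)
    π = hasLetter 1 a η
    η′ = removeLetter 1 a η
    byInduction : iverson (π ∧ ν) (qpow K *S contentSum r a K η′ n) ≐ maxTerm 1 p K η a
    byInduction with hasLetter 1 a η in present
    ... | false = Q.refl {zeroS}
    ... | true  = iverson-cong ν (*S-congˡ (qpow K) (IH η′ (P.trans (length-removeLetter η 1 a) |η|≡r)
                    (ℕP.suc-injective (P.trans (sum-removeLetter η 1 a present) Ση≡1+n))))

  hasContentFrom-empty : ∀ η i → sum η ≡ 0 → hasContentFrom i η [] ≡ true
  hasContentFrom-empty []           i Ση≡0 = P.refl
  hasContentFrom-empty (zero ∷ η)   i Ση≡0 = hasContentFrom-empty η (suc i) Ση≡0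

  boundedProduct-empty : ∀ η i p k → sum η ≡ 0 → boundedProduct i p k η ≐ oneS
  boundedProduct-empty []         i p k Ση≡0 = Q.refl {oneS}
  boundedProduct-empty (zero ∷ η) i p k Ση≡0 =
    Q.trans (*S-congˡ B (boundedProduct-empty η (suc i) p k Ση≡0)) (Q.trans (Q.*-identityʳ B) (sizeZero (i <ᵇ p) k))
    where
    B = if i <ᵇ p then qMultiset< k 0 else qMultiset k 0
    sizeZero : ∀ b k → (if b then qMultiset< k 0 else qMultiset k 0) ≐ oneS
    sizeZero true  zero    = Q.refl {oneS}
    sizeZero true  (suc k) = Q.refl {oneS}
    sizeZero false k       = Q.refl {oneS}

  qMultiset<Product-zero : ∀ η n → sum η ≡ suc n → qMultiset<Product 0 η ≐ zeroS
  qMultiset<Product-zero (zero ∷ η)  n Ση≡1+n = Q.trans (Q.*-identityˡ (qMultiset<Product 0 η)) (qMultiset<Product-zero η n Ση≡1+n)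
  qMultiset<Product-zero (suc e ∷ η) n Ση≡1+n = Q.zeroˡ (qMultiset<Product 0 η)

  boundedProduct-expand₁ : ∀ η p k r → length η ≡ r →
    boundedProduct 1 p k η ≐ qMultiset<Product k η +S ∑ r (λ x → maxTerm 1 p k η (suc x))
  boundedProduct-expand₁ η p k r P.refl = Q.trans (boundedProduct-expand η 1 p k)
    (+S-congˡ (qMultiset<Product k η) (Qᴾ.∑-cong (length η)
      (λ x _ → Q.reflexive (P.cong (maxTerm 1 p k η) (ℕP.+-comm x 1)))))

  -- Induction on the length n of the words, then on the bound k: the first value
  -- of a compatible sequence either equals k (the maxTerm summands) or is < k.
  contentSum≐boundedProduct : ∀ n k η p r → length η ≡ r → sum η ≡ n →
    contentSum r p k η n ≐ boundedProduct 1 p k η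
  contentSum≐boundedProduct zero k η p r |η|≡r Ση≡0
    rewrite hasContentFrom-empty η 1 Ση≡0 =
    Q.trans (Q.+-identityʳ oneS) (Q.sym (boundedProduct-empty η 1 p k Ση≡0))
  contentSum≐boundedProduct (suc n) zero η p r |η|≡r Ση≡1+n = begin
    contentSum r p 0 η (suc n)
      ≈⟨ ∑ᴸ-words-suc r n (λ w → iverson (hasContentFrom 1 η w) (compatibleSum p 0 w)) ⟩
    ∑ r (λ x → ∑ᴸ (words r n) (λ w → iverson (hasContentFrom 1 η (suc x ∷ w)) (compatibleSum p 0 (suc x ∷ w))))
      ≈⟨ Qᴾ.∑-cong r (λ x _ → Qᴾ.∑ᴸ-cong (words r n)
           (λ w → iverson-cong (hasContentFrom 1 η (suc x ∷ w)) (compatibleSum-∷-zero p (suc x) w))) ⟩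
    ∑ r (λ x → topStartSum r n p 0 η (suc x))
      ≈⟨ Qᴾ.∑-cong r (λ x x<r → topStartSum≐maxTerm r n p 0 η x x<r |η|≡r Ση≡1+n
           (λ η′ |η′|≡r Ση′≡n → contentSum≐boundedProduct n 0 η′ (suc x) r |η′|≡r Ση′≡n)) ⟩
    ∑ r (λ x → maxTerm 1 p 0 η (suc x))
      ≈⟨ Q.sym (Q.trans (+S-congʳ _ (qMultiset<Product-zero η n Ση≡1+n)) (Q.+-identityˡ _)) ⟩
    qMultiset<Product 0 η +S ∑ r (λ x → maxTerm 1 p 0 η (suc x))
      ≈⟨ Q.sym (boundedProduct-expand₁ η p 0 r |η|≡r) ⟩
    boundedProduct 1 p 0 η ∎
  contentSum≐boundedProduct (suc n) (suc k) η p r |η|≡r Ση≡1+n = begin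
    contentSum r p (suc k) η (suc n)
      ≈⟨ ∑ᴸ-words-suc r n (λ w → iverson (hasContentFrom 1 η w) (compatibleSum p (suc k) w)) ⟩
    ∑ r (λ x → ∑ᴸ (words r n) (λ w → iverson (content x w) (compatibleSum p (suc k) (suc x ∷ w))))
      ≈⟨ Qᴾ.∑-cong r (λ x _ → Qᴾ.∑ᴸ-cong (words r n) (λ w → Q.trans
           (iverson-cong (content x w) (compatibleSum-∷-suc p k (suc x) w))
           (iverson-+ (content x w) _ _))) ⟩
    ∑ r (λ x → ∑ᴸ (words r n) (λ w → top x w +S below x w))
      ≈⟨ Qᴾ.∑-cong r (λ x _ → Qᴾ.∑ᴸ-+ (words r n) (top x) (below x)) ⟩
    ∑ r (λ x → topStartSum r n p (suc k) η (suc x) +S ∑ᴸ (words r n) (below x))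
      ≈⟨ Qᴾ.∑-+ r (λ x → topStartSum r n p (suc k) η (suc x)) (λ x → ∑ᴸ (words r n) (below x)) ⟩
    ∑ r (λ x → topStartSum r n p (suc k) η (suc x)) +S ∑ r (λ x → ∑ᴸ (words r n) (below x))
      ≈⟨ Q.+-cong (Qᴾ.∑-cong r (λ x x<r → topStartSum≐maxTerm r n p (suc k) η x x<r |η|≡r Ση≡1+n
                      (λ η′ |η′|≡r Ση′≡n → contentSum≐boundedProduct n (suc k) η′ (suc x) r |η′|≡r Ση′≡n)))
                  (Q.trans (Q.sym (∑ᴸ-words-suc r n (λ w → iverson (hasContentFrom 1 η w) (compatibleSum 0 k w))))
                           (contentSum≐boundedProduct (suc n) k η 0 r |η|≡r Ση≡1+n)) ⟩
    ∑ r (λ x → maxTerm 1 p (suc k) η (suc x)) +S boundedProduct 1 0 k η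
      ≈⟨ Q.+-comm (∑ r (λ x → maxTerm 1 p (suc k) η (suc x))) (boundedProduct 1 0 k η) ⟩
    boundedProduct 1 0 k η +S ∑ r (λ x → maxTerm 1 p (suc k) η (suc x))
      ≈⟨ +S-congʳ _ (boundedProduct-≥ η 1 0 k z≤n) ⟩
    qMultiset<Product (suc k) η +S ∑ r (λ x → maxTerm 1 p (suc k) η (suc x))
      ≈⟨ Q.sym (boundedProduct-expand₁ η p (suc k) r |η|≡r) ⟩
    boundedProduct 1 p (suc k) η ∎
    where
    content : ℕ → List ℕ → Bool
    content x w = hasContentFrom 1 η (suc x ∷ w)
    top below : ℕ → List ℕ → PS
    top x w = iverson (content x w) (iverson (not (suc x <ᵇ p)) (qpow (suc k) *S compatibleSum (suc x) (suc k) w))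
    below x w = iverson (content x w) (compatibleSum 0 k (suc x ∷ w))


module DescentSide where

  open QSeries
  open Qᴾ using (∑; ∑ᴸ)
  open EhrhartSide using (qMultisetProduct)
  open Denominator using (qMultisetSeries≑invB-denom)
  open CompatibleSums
  open Content using (hasContent≡hasContentFrom)
  open BoundedProducts using (boundedProduct; boundedProduct-≥)
  open ContentSums
  import Data.Bool as 𝔹
  open import Relation.Binary.Reasoning.Setoid Q.setoid

  sumB-coefficient : ∀ {A : Set} (F : A → BS) xs j → sumB (map F xs) j ≐ ∑ᴸ xs (λ w → F w j)
  sumB-coefficient F []       j = Q.refl {zeroS}
  sumB-coefficient F (x ∷ xs) j = +S-congˡ (F x j) (sumB-coefficient F xs j)

  filter-iverson : ∀ b (x : PS) → (if does (b 𝔹.≟ true) then x else zeroS) ≡ iverson b x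
  filter-iverson true  x = P.refl
  filter-iverson false x = P.refl

  C*qMultisetSeries≐qMultisetProduct : ∀ η k →
    ∑ (suc k) (λ j → C η j *S qMultiset (k ∸ j) (sum η)) ≐ qMultisetProduct k η
  C*qMultisetSeries≐qMultisetProduct η k = begin
    ∑ (suc k) (λ j → C η j *S qMultiset (k ∸ j) n)
      ≈⟨ Qᴾ.∑-cong (suc k) (λ j _ → expandC j) ⟩
    ∑ (suc k) (λ j → ∑ᴸ (Sη η) (λ w → iverson (des w ≡ᵇ j) (qpow (maj w)) *S qMultiset (k ∸ j) n))
      ≈⟨ Qᴾ.∑ᴸ-swap (upTo (suc k)) (Sη η) (λ j w → iverson (des w ≡ᵇ j) (qpow (maj w)) *S qMultiset (k ∸ j) n) ⟩
    ∑ᴸ (Sη η) G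
      ≈⟨ Qᴾ.∑ᴸ-filter (λ w → hasContent η w 𝔹.≟ true) (words (length η) n) G ⟩
    ∑ᴸ (words (length η) n) (λ w → if does (hasContent η w 𝔹.≟ true) then G w else zeroS)
      ≈⟨ ∑ᴸ-words-cong (length η) n _ _ (λ w |w|≡n → Q.trans (Q.reflexive (filter-iverson (hasContent η w) (G w)))
           (Q.trans (iverson-cong (hasContent η w) (Q.sym (compatibleSum-zero w k n |w|≡n)))
                    (Q.reflexive (P.cong (λ b → iverson b (compatibleSum 0 k w)) (hasContent≡hasContentFrom η w))))) ⟩
    contentSum (length η) 0 k η n
      ≈⟨ contentSum≐boundedProduct n k η 0 (length η) P.refl P.refl ⟩
    boundedProduct 1 0 k η
      ≈⟨ boundedProduct-≥ η 1 0 k z≤n ⟩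
    qMultisetProduct k η ∎
    where
    n = sum η
    G : List ℕ → PS
    G w = ∑ (suc k) (λ j → iverson (des w ≡ᵇ j) (qpow (maj w)) *S qMultiset (k ∸ j) n)
    expandC : ∀ j → C η j *S qMultiset (k ∸ j) n ≐ ∑ᴸ (Sη η) (λ w → iverson (des w ≡ᵇ j) (qpow (maj w)) *S qMultiset (k ∸ j) n)
    expandC j = Q.trans (*S-congʳ (qMultiset (k ∸ j) n) (sumB-coefficient (λ w → monoB (maj w) (des w)) (Sη η) j))
                        (Qᴾ.∑ᴸ-*ʳ (Sη η) (qMultiset (k ∸ j) n) (λ w → iverson (des w ≡ᵇ j) (qpow (maj w))))

  C*invB-denom≐middle : ∀ η k → (C η *B invB (denom (sum η))) k ≐ middle η k
  C*invB-denom≐middle η k = begin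
    (C η *B invB (denom (sum η))) k
      ≈⟨ Qᴾ.conv-cong {C η} {C η} (λ j → Q.refl {C η j}) (λ j → Q.sym (qMultisetSeries≑invB-denom (sum η) j)) k ⟩
    ∑ (suc k) (λ j → C η j *S qMultiset (k ∸ j) (sum η))
      ≈⟨ C*qMultisetSeries≐qMultisetProduct η k ⟩
    qMultisetProduct k η
      ≈⟨ Q.sym (EhrhartSide.middle≐qMultisetProduct η k) ⟩
    middle η k ∎


open QSeries using (module Q)

theorem3p1 : (η : List ℕ) → All (λ e → 1 ≤ e) η →
    ((C η *B invB (denom (sum η))) ≈B middle η) × (middle η ≈B Ehr η)
theorem3p1 η _ =
    DescentSide.C*invB-denom≐middle η
  , λ k → Q.trans (EhrhartSide.middle≐qMultisetProduct η k) (Q.sym (EhrhartSide.Ehr≐qMultisetProduct η k))
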